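{- For $n\ge 2$, $a_n(12;2\to 3)=2B_{n-1}$, and $a_1(12;2\to 3)=1$, where $B_m$ is the $m$-th Bell number.
   Context: Standard cycle form of $\sigma\in S_n$: product of disjoint cycles (fixed points included), each cycle starting with its largest element, cycles listed in increasing order of largest elements. The fundamental bijection $\theta:S_n\to S_n$ erases the parentheses of the standard cycle form to give a one-line permutation. For $\pi\in S_n$, $\hat\pi=\theta^{ -1}(\pi)$. An arrow pattern $(\nu;H)$ of size $k$: a string $\nu=a_1\dots a_m$ of positive integers and a set $H$ of arrows $b\to c$, with all integers appearing forming $[k]$. $\pi\in S_n$ contains $(\nu;H)$ if there is $X=\{x_1<\dots<x_k\}\subseteq[n]$ with positions $t_1<\dots<t_m$ such that $\pi_{t_1}\cdots\pi_{t_m}=x_{a_1}\cdots x_{a_m}$ and $\hat\pi(x_b)=x_c$ for every arrow $b\to c\in H$; otherwise it avoids it. $a_n(\nu;H)$ = number of $\pi\in S_n$ avoiding $(\nu;H)$. $B_m$ is the number of set partitions of $[m]$. -}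

module Defs where

open import Data.Bool using (Bool; true; false; _∧_; _∨_; not; if_then_else_)
open import Data.Nat using (ℕ; zero; suc; _+_; _*_; _∸_; _≡ᵇ_; _≤ᵇ_; _<ᵇ_)
open import Data.Nat.Combinatorics using (_C_)
open import Data.List using (List; []; _∷_; _++_; map; concat; concatMap; length; zipWith; foldr; upTo)
open import Data.Nat.ListAction using (sum)
open import Data.Product using (_×_; _,_)

range1 : ℕ → List ℕ
range1 n = map suc (upTo n)

eqList : List ℕ → List ℕ → Bool
eqList []       []       = true
eqList (x ∷ xs) (y ∷ ys) = (x ≡ᵇ y) ∧ eqList xs ys
eqList _        _        = false

allB : {A : Set} → (A → Bool) → List A → Bool
allB p = foldr (λ x b → p x ∧ b) true

anyB : {A : Set} → (A → Bool) → List A → Bool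
anyB p = foldr (λ x b → p x ∨ b) false

filterB : {A : Set} → (A → Bool) → List A → List A
filterB p []       = []
filterB p (x ∷ xs) = if p x then x ∷ filterB p xs else filterB p xs

countB : {A : Set} → (A → Bool) → List A → ℕ
countB p = foldr (λ x c → if p x then suc c else c) 0

-- 1-based indexing with default 0 (0 is never a letter of a permutation)
at : List ℕ → ℕ → ℕ
at []       _             = 0
at (x ∷ xs) zero          = 0
at (x ∷ xs) (suc zero)    = x
at (x ∷ xs) (suc (suc i)) = at xs (suc i)

subseqs : List ℕ → List (List ℕ)
subseqs []       = [] ∷ []
subseqs (x ∷ xs) = map (x ∷_) (subseqs xs) ++ subseqs xs

-- Permutations of [n] in one-line notation: a list π₁ … πₙ;
-- as a map, π(i) = πᵢ  (i.e. `at π i`).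

insertEverywhere : ℕ → List ℕ → List (List ℕ)
insertEverywhere x []       = (x ∷ []) ∷ []
insertEverywhere x (y ∷ ys) = (x ∷ y ∷ ys) ∷ map (y ∷_) (insertEverywhere x ys)

permsOf : List ℕ → List (List ℕ)
permsOf []       = [] ∷ []
permsOf (x ∷ xs) = concatMap (insertEverywhere x) (permsOf xs)

S : ℕ → List (List ℕ)
S n = permsOf (range1 n)

-- the cycle of σ through m, written m, σ(m), σ²(m), …  (fuel = n suffices)
orbitFrom : List ℕ → ℕ → ℕ → ℕ → List ℕ
orbitFrom σ m zero       x = []
orbitFrom σ m (suc fuel) x =
  x ∷ (if at σ x ≡ᵇ m then [] else orbitFrom σ m fuel (at σ x))

cycleOf : List ℕ → ℕ → List ℕ
cycleOf σ m = orbitFrom σ m (length σ) m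

isCycleMax : List ℕ → ℕ → Bool
isCycleMax σ m = allB (λ y → y ≤ᵇ m) (cycleOf σ m)

-- standard cycle form: each cycle starts with its largest element,
-- cycles listed in increasing order of their largest elements
standardCycleForm : List ℕ → List (List ℕ)
standardCycleForm σ = map (cycleOf σ) (filterB (λ m → isCycleMax σ m) (range1 (length σ)))

θ : List ℕ → List ℕ
θ σ = concat (standardCycleForm σ)

-- π̂ = θ⁻¹(π): the σ ∈ S_n with θ(σ) = π  (default [] never occurs)
firstSuch : {A : Set} → (A → Bool) → A → List A → A
firstSuch p d []       = d
firstSuch p d (x ∷ xs) = if p x then x else firstSuch p d xs

hat : List ℕ → List ℕ
hat π = firstSuch (λ σ → eqList (θ σ) π) [] (S (length π))

-- increasing k-subsets X = {x₁ < … < x_k} of [n], as sorted lists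
kSubsets : ℕ → ℕ → List (List ℕ)
kSubsets n k = filterB (λ X → length X ≡ᵇ k) (subseqs (range1 n))

-- π contains (ν; H) (of size k): some X = {x₁<…<x_k} ⊆ [n] and positions
-- t₁<…<tₘ with π_{t₁}…π_{tₘ} = x_{a₁}…x_{aₘ} and π̂(x_b) = x_c for b→c ∈ H
contains : ℕ → List ℕ → List (ℕ × ℕ) → List ℕ → Bool
contains k ν H π =
  anyB (λ X →
    anyB (λ s → eqList s (map (at X) ν)) (subseqs π)
    ∧ allB (λ { (b , c) → at (hat π) (at X b) ≡ᵇ at X c }) H)
  (kSubsets (length π) k)

avoids : ℕ → List ℕ → List (ℕ × ℕ) → List ℕ → Bool
avoids k ν H π = not (contains k ν H π)

a : ℕ → ℕ → List ℕ → List (ℕ × ℕ) → ℕ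
a n k ν H = countB (avoids k ν H) (S n)

-- Bell numbers: B₀ = 1, B_{m+1} = Σ_{j=0}^{m} (m choose j) B_j

bellList : ℕ → List ℕ   -- [B₀, …, B_m]
bellList zero    = 1 ∷ []
bellList (suc m) = bellList m ++
  (sum (zipWith (λ j b → (m C j) * b) (upTo (suc m)) (bellList m)) ∷ [])

Bell : ℕ → ℕ
Bell m = at (bellList m) (suc m)

module Submission where

open import Defs
open import Data.Bool using (Bool; true; false; T; _∧_; _∨_; not; if_then_else_)
open import Data.Bool.Properties using (T-∧; T-∨; T-≡)
open import Data.Nat using (ℕ; zero; suc; _+_; _*_; _≤_; _<_; z≤n; s≤s; _≡ᵇ_; _≤ᵇ_; _<?_; _≟_; _∸_)
open import Data.Nat.Properties using (≡ᵇ⇒≡; ≡⇒≡ᵇ; <⇒≢; +-commutativeSemigroup; +-comm; +-assoc; +-identityʳ; *-identityˡ; *-distribʳ-+; *-distribˡ-+; n<1+n; <-trans; <-asym; ≤∧≢⇒<; <-irrefl; <-≤-trans; <⇒≤; ≤-refl; ≤-trans; m≤n+m; m≤m+n; +-suc; ≤-reflexive; ≮⇒≥; ≤ᵇ⇒≤; ≤⇒≤ᵇ; ≤-<-trans; m<n+m; +-cancelˡ-≡; ≤-pred; <-cmp)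
open import Data.List using (List; []; _∷_; _++_; map; concat; concatMap; length; filter; filterᵇ; [_]; applyUpTo; upTo; zipWith; _∷ʳ_; reverse)
open import Data.Bool.ListAction using (any; all)
open import Data.List.Properties using (∷-injective; length-map; length-applyUpTo; applyUpTo-∷ʳ; length-++; reverse-++; reverse-involutive; ++-assoc; unfold-reverse; map-++; map-∘; ++-cancelˡ; map-cong-local; reverse-injective; ++-identityʳ; map-applyUpTo)
open import Data.List.Membership.Propositional using (_∈_; _∉_; find; lose)
open import Data.List.Membership.Propositional.Properties using (∈-filter⁺; ∈-filter⁻; ∈-map⁺; ∈-map⁻; ∈-++⁺ˡ; ∈-++⁺ʳ; ∈-++⁻; ∈-∃++; ∈-concatMap⁺; ∈-concatMap⁻; ∈-applyUpTo⁺; ∈-applyUpTo⁻; ∈-concat⁺′)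
open import Data.List.Membership.Propositional.Properties.WithK using (unique∧set⇒bag)
open import Data.List.Relation.Binary.BagAndSetEquality using (∼bag⇒↭)
open import Data.List.Relation.Binary.Permutation.Propositional using (_↭_; ↭-refl; ↭-sym; ↭-trans; ↭-prep; ↭⇒↭ₛ; ↭-swap; module PermutationReasoning)
open import Data.List.Relation.Binary.Permutation.Propositional.Properties using (↭-length; shift; drop-mid; ∈-resp-↭; All-resp-↭; ↭-reverse; drop-∷; ++⁺ˡ; ++⁺ʳ; ++-comm; ↭-empty-inv; ↭-singleton-inv; map⁺)
open import Data.List.Relation.Unary.All using (All; []; _∷_; all?)
open import Data.List.Relation.Unary.Any using (Any; here; there)
open import Data.List.Relation.Unary.Unique.Propositional using (Unique)
open import Data.List.Relation.Unary.AllPairs using (AllPairs; []; _∷_)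
open import Data.Sum using (inj₁; inj₂; _⊎_; [_,_]′)
open import Data.Product using (Σ; ∃; ∃₂; _×_; _,_; proj₁; proj₂; uncurry)
open import Data.Empty using (⊥; ⊥-elim)
open import Function using (_∘_; _⇔_; mk⇔; Equivalence; case_of_)
open import Relation.Nullary using (¬_; Dec; yes; no; T?; _×-dec_; _⊎-dec_)
open import Relation.Binary.PropositionalEquality using (_≡_; refl; sym; trans; cong; cong₂; subst; _≢_; module ≡-Reasoning)
open import Relation.Binary.PropositionalEquality.Properties using (setoid)
open import Data.Nat.Combinatorics using (_C_; nCk+nC[k+1]≡[n+1]C[k+1]; k>n⇒nCk≡0)
open import Data.Nat.ListAction using (sum)
open import Data.Nat.ListAction.Properties using (sum-++)
open import Algebra.Properties.CommutativeSemigroup +-commutativeSemigroup using (interchange)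
open import Data.Unit using (⊤; tt)
open import Data.List.Reverse using (Reverse; []; _∶_∶ʳ_; reverseView)
open import Relation.Binary.Core using (Rel)
open import Data.List.Relation.Unary.Linked using (Linked; []; [-]; _∷_)
open import Data.List.Relation.Unary.All.Properties using (all⁺; all⁻; ¬All⇒Any¬)
open import Relation.Binary.Definitions using (tri<; tri≈; tri>)
open import Data.List.Relation.Unary.Any.Properties using (any⁺; any⁻)
import Data.List.Relation.Unary.Unique.Propositional.Properties as Unique
import Data.List.Relation.Unary.AllPairs.Properties as AllPairs
import Data.List.Relation.Binary.Permutation.Setoid.Properties as SetoidPerm′
import Data.List.Relation.Unary.All as All
import Data.List.Relation.Unary.Any.Properties as Any
import Data.List.Relation.Unary.AllPairs as AllPairs
import Data.Sum as Sum
import Data.List.Relation.Ternary.Interleaving.Propositional as Interleaving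
import Data.Nat.Properties
import Data.List.Relation.Unary.All.Properties as All
import Data.Sum
import Data.List.Relation.Unary.Linked as Linked
import Relation.Binary.PropositionalEquality

module _ {A : Set} (p : A → Bool) where

  anyB⁻ : ∀ xs → T (anyB p xs) → ∃ λ x → x ∈ xs × T (p x)
  anyB⁻ (x ∷ xs) px∨ with Equivalence.to T-∨ px∨
  ... | inj₁ px   = x , here refl , px
  ... | inj₂ pxs = let y , y∈ , py = anyB⁻ xs pxs in y , there y∈ , py

  anyB⁺ : ∀ xs {x} → x ∈ xs → T (p x) → T (anyB p xs)
  anyB⁺ (y ∷ xs) (here refl) px = Equivalence.from T-∨ (inj₁ px)
  anyB⁺ (y ∷ xs) (there x∈)  px = Equivalence.from T-∨ (inj₂ (anyB⁺ xs x∈ px))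

  allB≡all : ∀ xs → allB p xs ≡ all p xs
  allB≡all []       = refl
  allB≡all (x ∷ xs) = cong (p x ∧_) (allB≡all xs)

  filterB≡filterᵇ : ∀ xs → filterB p xs ≡ filterᵇ p xs
  filterB≡filterᵇ []       = refl
  filterB≡filterᵇ (x ∷ xs) with p x
  ... | true  = cong (x ∷_) (filterB≡filterᵇ xs)
  ... | false = filterB≡filterᵇ xs

  countB≡length-filterᵇ : ∀ xs → countB p xs ≡ length (filterᵇ p xs)
  countB≡length-filterᵇ []       = refl
  countB≡length-filterᵇ (x ∷ xs) with p x
  ... | true  = cong suc (countB≡length-filterᵇ xs)
  ... | false = countB≡length-filterᵇ xs

  countB-unique : ∀ {xs ys} → Unique xs → Unique ys →
                  (∀ {y} → y ∈ ys ⇔ (y ∈ xs × T (p y))) → countB p xs ≡ length ys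
  countB-unique {xs} {ys} xs! ys! ys≡ = trans (countB≡length-filterᵇ xs) (↭-length filter↭ys)
    where
    filter↭ys : filterᵇ p xs ↭ ys
    filter↭ys = ∼bag⇒↭ (unique∧set⇒bag (Unique.filter⁺ (T? ∘ p) xs!) ys!
      (mk⇔ (λ y∈ → Equivalence.from ys≡ (∈-filter⁻ (T? ∘ p) y∈))
           (λ y∈ → let (y∈xs , py) = Equivalence.to ys≡ y∈ in ∈-filter⁺ (T? ∘ p) y∈xs py)))

  firstSuch-satisfies : ∀ d xs {x} → x ∈ xs → T (p x) → firstSuch p d xs ∈ xs × T (p (firstSuch p d xs))
  firstSuch-satisfies d (y ∷ xs) x∈ px with p y in py
  ... | true = here refl , subst T (sym py) _
  firstSuch-satisfies d (y ∷ xs) (here refl) px | false = ⊥-elim (subst T py px)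
  firstSuch-satisfies d (y ∷ xs) (there x∈) px  | false =
    let (f∈ , pf) = firstSuch-satisfies d xs x∈ px in there f∈ , pf

  ∈-filterB⁻ : ∀ xs {y} → y ∈ filterB p xs → y ∈ xs × T (p y)
  ∈-filterB⁻ xs y∈ = ∈-filter⁻ (T? ∘ p) (subst (_ ∈_) (filterB≡filterᵇ xs) y∈)

  ∈-filterB⁺ : ∀ xs {y} → y ∈ xs → T (p y) → y ∈ filterB p xs
  ∈-filterB⁺ xs y∈ py = subst (_ ∈_) (sym (filterB≡filterᵇ xs)) (∈-filter⁺ (T? ∘ p) y∈ py)

  filterB-AllPairs : ∀ {R : A → A → Set} {xs} → AllPairs R xs → AllPairs R (filterB p xs)
  filterB-AllPairs {xs = xs} R-xs = subst (AllPairs _) (sym (filterB≡filterᵇ xs)) (AllPairs.filter⁺ (T? ∘ p) R-xs)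

eqList-refl : ∀ xs → T (eqList xs xs)
eqList-refl []       = _
eqList-refl (x ∷ xs) = Equivalence.from T-∧ (≡⇒≡ᵇ x x refl , eqList-refl xs)

eqList-sound : ∀ xs ys → T (eqList xs ys) → xs ≡ ys
eqList-sound []       []       _  = refl
eqList-sound (x ∷ xs) (y ∷ ys) eq =
  let x≡ᵇy , xs≡ys = Equivalence.to T-∧ eq in cong₂ _∷_ (≡ᵇ⇒≡ x y x≡ᵇy) (eqList-sound xs ys xs≡ys)

module SetoidPerm = SetoidPerm′ (setoid ℕ)

∈-insertEverywhere⁻ : ∀ x xs {τ} → τ ∈ insertEverywhere x xs →
                      ∃₂ λ u v → xs ≡ u ++ v × τ ≡ u ++ x ∷ v
∈-insertEverywhere⁻ x []       (here refl) = [] , [] , refl , refl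
∈-insertEverywhere⁻ x (y ∷ ys) (here refl) = [] , y ∷ ys , refl , refl
∈-insertEverywhere⁻ x (y ∷ ys) (there τ∈) with ∈-map⁻ (y ∷_) τ∈
... | τ′ , τ′∈ , refl with ∈-insertEverywhere⁻ x ys τ′∈
...   | u , v , refl , refl = y ∷ u , v , refl , refl

∈-insertEverywhere⁺ : ∀ x u v → u ++ x ∷ v ∈ insertEverywhere x (u ++ v)
∈-insertEverywhere⁺ x []      []      = here refl
∈-insertEverywhere⁺ x []      (y ∷ v) = here refl
∈-insertEverywhere⁺ x (y ∷ u) v       = there (∈-map⁺ (y ∷_) (∈-insertEverywhere⁺ x u v))

∈-permsOf⁻ : ∀ xs {π} → π ∈ permsOf xs → π ↭ xs
∈-permsOf⁻ []       (here refl) = ↭-refl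
∈-permsOf⁻ (x ∷ xs) π∈ with find (∈-concatMap⁻ (insertEverywhere x) {xs = permsOf xs} π∈)
... | ρ , ρ∈ , π∈′ with ∈-insertEverywhere⁻ x ρ π∈′
...   | u , v , refl , refl = ↭-trans (shift x u v) (↭-prep x (∈-permsOf⁻ xs ρ∈))

∈-permsOf⁺ : ∀ xs {π} → π ↭ xs → π ∈ permsOf xs
∈-permsOf⁺ []       {[]}    _  = here refl
∈-permsOf⁺ []       {y ∷ π} p with () ← ∈-resp-↭ p (here refl)
∈-permsOf⁺ (x ∷ xs) p with ∈-∃++ (∈-resp-↭ (↭-sym p) (here refl))
... | u , v , refl = ∈-concatMap⁺ (insertEverywhere x)
      (lose (∈-permsOf⁺ xs (drop-mid u [] p)) (∈-insertEverywhere⁺ x u v))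

module _ {A B : Set} (f : A → List B) where

  concatMap-unique : ∀ {xs} → Unique xs → (∀ {x} → x ∈ xs → Unique (f x)) →
                     (∀ {x y z} → x ∈ xs → y ∈ xs → z ∈ f x → z ∈ f y → x ≡ y) →
                     Unique (concatMap f xs)
  concatMap-unique {[]}     _             _    _     = []
  concatMap-unique {x ∷ xs} (x≢xs ∷ xs!) f!  f-inj =
    Unique.++⁺ (f! (here refl))
      (concatMap-unique xs! (f! ∘ there) (λ x∈ y∈ → f-inj (there x∈) (there y∈)))
      disjoint
    where
    disjoint : ∀ {z} → z ∈ f x × z ∈ concatMap f xs → ⊥
    disjoint (z∈fx , z∈) with find (∈-concatMap⁻ f {xs = xs} z∈)
    ... | y , y∈ , z∈fy = All.lookup x≢xs y∈ (f-inj (here refl) (there y∈) z∈fx z∈fy)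

∷-≢-split : ∀ {A : Set} {x : A} u {v u′ v′} → x ∉ u → x ∉ u′ →
            u ++ x ∷ v ≡ u′ ++ x ∷ v′ → u ≡ u′ × v ≡ v′
∷-≢-split []      {u′ = []}     _    _     refl = refl , refl
∷-≢-split []      {u′ = y ∷ u′} _    x∉u′  eq   with refl , _ ← ∷-injective eq = ⊥-elim (x∉u′ (here refl))
∷-≢-split (y ∷ u) {u′ = []}     x∉u  _     eq   with refl , _ ← ∷-injective eq = ⊥-elim (x∉u (here refl))
∷-≢-split (y ∷ u) {u′ = _ ∷ u′} x∉u  x∉u′  eq   with refl , eq′ ← ∷-injective eq
  with refl , refl ← ∷-≢-split u (x∉u ∘ there) (x∉u′ ∘ there) eq′ = refl , refl

insertEverywhere-unique : ∀ x xs → x ∉ xs → Unique (insertEverywhere x xs)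
insertEverywhere-unique x []       _   = [] ∷ []
insertEverywhere-unique x (y ∷ ys) x∉ =
  All.tabulate head-differs ∷ Unique.map⁺ (proj₂ ∘ ∷-injective) (insertEverywhere-unique x ys (x∉ ∘ there))
  where
  head-differs : ∀ {τ} → τ ∈ map (y ∷_) (insertEverywhere x ys) → x ∷ y ∷ ys ≢ τ
  head-differs τ∈ refl with ∈-map⁻ (y ∷_) τ∈
  ... | _ , _ , eq = x∉ (here (proj₁ (∷-injective eq)))

insertEverywhere-injective : ∀ x {xs ys τ} → x ∉ xs → x ∉ ys →
                             τ ∈ insertEverywhere x xs → τ ∈ insertEverywhere x ys → xs ≡ ys
insertEverywhere-injective x {xs} {ys} x∉xs x∉ys τ∈xs τ∈ys
  with ∈-insertEverywhere⁻ x xs τ∈xs | ∈-insertEverywhere⁻ x ys τ∈ys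
... | u , v , refl , refl | u′ , v′ , refl , eq
  with refl , refl ← ∷-≢-split u (x∉xs ∘ ∈-++⁺ˡ) (x∉ys ∘ ∈-++⁺ˡ) eq = refl

permsOf-unique : ∀ {xs} → Unique xs → Unique (permsOf xs)
permsOf-unique {[]}     _            = [] ∷ []
permsOf-unique {x ∷ xs} (x≢xs ∷ xs!) =
  concatMap-unique (insertEverywhere x) (permsOf-unique xs!)
    (λ ρ∈ → insertEverywhere-unique x _ (x∉ ρ∈))
    (λ ρ∈ ρ′∈ → insertEverywhere-injective x (x∉ ρ∈) (x∉ ρ′∈))
  where
  x∉ : ∀ {ρ} → ρ ∈ permsOf xs → x ∉ ρ
  x∉ ρ∈ x∈ρ = All.lookup x≢xs (∈-resp-↭ (∈-permsOf⁻ xs ρ∈) x∈ρ) refl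

↭-unique : ∀ {xs ys : List ℕ} → xs ↭ ys → Unique ys → Unique xs
↭-unique p = SetoidPerm.Unique-resp-↭ (↭⇒↭ₛ (↭-sym p))

range1-increasing : ∀ n → AllPairs _<_ (range1 n)
range1-increasing n = AllPairs.map⁺ (AllPairs.map s≤s (AllPairs.applyUpTo⁺₁ (λ i → i) n (λ i<j _ → i<j)))

increasing⇒unique : ∀ {xs} → AllPairs _<_ xs → Unique xs
increasing⇒unique = AllPairs.map <⇒≢

∈-range1⁻ : ∀ n {x} → x ∈ range1 n → 1 ≤ x × x ≤ n
∈-range1⁻ n x∈ with ∈-map⁻ suc x∈
... | i , i∈ , refl with ∈-applyUpTo⁻ (λ i → i) i∈
...   | _ , i<n , refl = s≤s z≤n , i<n

∈-range1⁺ : ∀ n {x} → 1 ≤ x → x ≤ n → x ∈ range1 n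
∈-range1⁺ n {suc x} _ x<n = ∈-map⁺ suc (∈-applyUpTo⁺ (λ i → i) x<n)

length-range1 : ∀ n → length (range1 n) ≡ n
length-range1 n = trans (length-map suc (upTo n)) (length-applyUpTo (λ i → i) n)

record IsPermutation (n : ℕ) (π : List ℕ) : Set where
  field
    unique : Unique π
    ∈⇒≤    : ∀ {x} → x ∈ π → 1 ≤ x × x ≤ n
    ≤⇒∈    : ∀ {x} → 1 ≤ x × x ≤ n → x ∈ π
    length≡ : length π ≡ n

↭range1⇒IsPermutation : ∀ {n π} → π ↭ range1 n → IsPermutation n π
↭range1⇒IsPermutation {n} p = record
  { unique  = ↭-unique p (increasing⇒unique (range1-increasing n))
  ; ∈⇒≤     = ∈-range1⁻ n ∘ ∈-resp-↭ p
  ; ≤⇒∈     = λ (1≤x , x≤n) → ∈-resp-↭ (↭-sym p) (∈-range1⁺ n 1≤x x≤n)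
  ; length≡ = trans (↭-length p) (length-range1 n)
  }

∈-S⇒IsPermutation : ∀ n {π} → π ∈ S n → IsPermutation n π
∈-S⇒IsPermutation n = ↭range1⇒IsPermutation ∘ ∈-permsOf⁻ (range1 n)

S-unique : ∀ n → Unique (S n)
S-unique n = permsOf-unique (increasing⇒unique (range1-increasing n))

sum-applyUpTo-suc : ∀ h n → sum (applyUpTo h (suc n)) ≡ sum (applyUpTo h n) + h n
sum-applyUpTo-suc h n = begin
  sum (applyUpTo h (suc n))      ≡⟨ cong sum (applyUpTo-∷ʳ h n) ⟨
  sum (applyUpTo h n ++ [ h n ]) ≡⟨ sum-++ (applyUpTo h n) [ h n ] ⟩
  sum (applyUpTo h n) + (h n + 0) ≡⟨ cong (sum (applyUpTo h n) +_) (+-identityʳ (h n)) ⟩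
  sum (applyUpTo h n) + h n      ∎
  where open ≡-Reasoning

sum-applyUpTo-+ : ∀ f g n → sum (applyUpTo (λ j → f j + g j) n) ≡ sum (applyUpTo f n) + sum (applyUpTo g n)
sum-applyUpTo-+ f g zero    = refl
sum-applyUpTo-+ f g (suc n) = trans (cong (f 0 + g 0 +_) (sum-applyUpTo-+ (f ∘ suc) (g ∘ suc) n))
                                    (interchange (f 0) (g 0) _ _)

sum-applyUpTo-cong : ∀ {f g} → (∀ j → f j ≡ g j) → ∀ n → sum (applyUpTo f n) ≡ sum (applyUpTo g n)
sum-applyUpTo-cong f≗g zero    = refl
sum-applyUpTo-cong f≗g (suc n) = cong₂ _+_ (f≗g 0) (sum-applyUpTo-cong (f≗g ∘ suc) n)

binomialTransform : (ℕ → ℕ) → ℕ → ℕ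
binomialTransform g zero    = g zero
binomialTransform g (suc m) = binomialTransform g m + binomialTransform (g ∘ suc) m

binomialTransform-sum : ∀ g m → binomialTransform g m ≡ sum (applyUpTo (λ j → (m C j) * g j) (suc m))
binomialTransform-sum g zero    = sym (trans (+-identityʳ (1 * g 0)) (*-identityˡ (g 0)))
binomialTransform-sum g (suc m) = begin
  binomialTransform g m + binomialTransform (g ∘ suc) m
    ≡⟨ cong₂ _+_ (binomialTransform-sum g m) (binomialTransform-sum (g ∘ suc) m) ⟩
  (1 * g 0 + sum (applyUpTo (λ j → (m C suc j) * g (suc j)) m)) + sum (applyUpTo (λ j → (m C j) * g (suc j)) (suc m))
    ≡⟨ cong₂ (λ a b → a + b + sum (applyUpTo (λ j → (m C j) * g (suc j)) (suc m))) (*-identityˡ (g 0)) drop-last ⟩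
  g 0 + sum (applyUpTo (λ j → (m C suc j) * g (suc j)) (suc m)) + sum (applyUpTo (λ j → (m C j) * g (suc j)) (suc m))
    ≡⟨ +-assoc (g 0) (sum (applyUpTo (λ j → (m C suc j) * g (suc j)) (suc m))) _ ⟩
  g 0 + (sum (applyUpTo (λ j → (m C suc j) * g (suc j)) (suc m)) + sum (applyUpTo (λ j → (m C j) * g (suc j)) (suc m)))
    ≡⟨ cong (g 0 +_) (sym (sum-applyUpTo-+ (λ j → (m C suc j) * g (suc j)) (λ j → (m C j) * g (suc j)) (suc m))) ⟩
  g 0 + sum (applyUpTo (λ j → (m C suc j) * g (suc j) + (m C j) * g (suc j)) (suc m))
    ≡⟨ cong₂ _+_ (sym (*-identityˡ (g 0))) (sum-applyUpTo-cong pascal (suc m)) ⟩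
  1 * g 0 + sum (applyUpTo (λ j → (suc m C suc j) * g (suc j)) (suc m)) ∎
  where
  open ≡-Reasoning
  drop-last : sum (applyUpTo (λ j → (m C suc j) * g (suc j)) m) ≡ sum (applyUpTo (λ j → (m C suc j) * g (suc j)) (suc m))
  drop-last = sym (trans (sum-applyUpTo-suc (λ j → (m C suc j) * g (suc j)) m)
                         (trans (cong (λ c → total + c * g (suc m)) (k>n⇒nCk≡0 (n<1+n m))) (+-identityʳ total)))
    where total = sum (applyUpTo (λ j → (m C suc j) * g (suc j)) m)
  pascal : ∀ j → (m C suc j) * g (suc j) + (m C j) * g (suc j) ≡ (suc m C suc j) * g (suc j)
  pascal j = trans (sym (*-distribʳ-+ (g (suc j)) (m C suc j) (m C j)))
                   (cong (_* g (suc j)) (trans (+-comm (m C suc j) (m C j)) (nCk+nC[k+1]≡[n+1]C[k+1] m j)))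

binomialTransform-* : ∀ k g m → binomialTransform (λ j → k * g j) m ≡ k * binomialTransform g m
binomialTransform-* k g zero    = refl
binomialTransform-* k g (suc m) =
  trans (cong₂ _+_ (binomialTransform-* k g m) (binomialTransform-* k (g ∘ suc) m)) (sym (*-distribˡ-+ k _ _))

at-snoc : ∀ xs x → at (xs ++ [ x ]) (suc (length xs)) ≡ x
at-snoc []           x = refl
at-snoc (y ∷ [])     x = refl
at-snoc (y ∷ z ∷ xs) x = at-snoc (z ∷ xs) x

length-bellList : ∀ m → length (bellList m) ≡ suc m
length-bellList zero    = refl
length-bellList (suc m) = trans (length-++ (bellList m)) (trans (cong (_+ 1) (length-bellList m)) (+-comm (suc m) 1))

Bell-suc-sum : ∀ m → Bell (suc m) ≡ sum (zipWith (λ j b → (m C j) * b) (upTo (suc m)) (bellList m))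
Bell-suc-sum m = trans (cong (λ ℓ → at (bellList m ++ [ s ]) (suc ℓ)) (sym (length-bellList m)))
                       (at-snoc (bellList m) s)
  where s = sum (zipWith (λ j b → (m C j) * b) (upTo (suc m)) (bellList m))

bellList≡applyUpTo : ∀ m → bellList m ≡ applyUpTo Bell (suc m)
bellList≡applyUpTo zero    = refl
bellList≡applyUpTo (suc m) = begin
  bellList m ++ [ s ]                ≡⟨ cong₂ (λ xs x → xs ++ [ x ]) (bellList≡applyUpTo m) (sym (Bell-suc-sum m)) ⟩
  applyUpTo Bell (suc m) ∷ʳ Bell (suc m) ≡⟨ applyUpTo-∷ʳ Bell (suc m) ⟩
  applyUpTo Bell (suc (suc m))       ∎
  where
  open ≡-Reasoning
  s = sum (zipWith (λ j b → (m C j) * b) (upTo (suc m)) (bellList m))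

zipWith-applyUpTo : ∀ (f : ℕ → ℕ → ℕ) g h n → zipWith f (applyUpTo g n) (applyUpTo h n) ≡ applyUpTo (λ j → f (g j) (h j)) n
zipWith-applyUpTo f g h zero    = refl
zipWith-applyUpTo f g h (suc n) = cong (f (g 0) (h 0) ∷_) (zipWith-applyUpTo f (g ∘ suc) (h ∘ suc) n)

Bell-suc : ∀ m → Bell (suc m) ≡ binomialTransform Bell m
Bell-suc m = begin
  Bell (suc m)                                                              ≡⟨ Bell-suc-sum m ⟩
  sum (zipWith (λ j b → (m C j) * b) (upTo (suc m)) (bellList m))            ≡⟨ cong (λ bs → sum (zipWith (λ j b → (m C j) * b) (upTo (suc m)) bs)) (bellList≡applyUpTo m) ⟩
  sum (zipWith (λ j b → (m C j) * b) (upTo (suc m)) (applyUpTo Bell (suc m))) ≡⟨ cong sum (zipWith-applyUpTo (λ j b → (m C j) * b) (λ j → j) Bell (suc m)) ⟩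
  sum (applyUpTo (λ j → (m C j) * Bell j) (suc m))                           ≡⟨ binomialTransform-sum Bell m ⟨
  binomialTransform Bell m                                                  ∎

  where open ≡-Reasoning

Extreme : ℕ → List ℕ → Set
Extreme x τ = All (x <_) τ ⊎ All (_< x) τ

-- GoodFrom p τ and Good τ are read on a reversed permutation τ = reverse π, where
-- an entry is compared with the entries after it and p is the entry just before τ.
GoodFrom : ℕ → List ℕ → Set
GoodFrom p []      = ⊤
GoodFrom p (y ∷ τ) = (Extreme y τ ⊎ p < y) × GoodFrom y τ

Good : List ℕ → Set
Good []      = ⊤
Good (y ∷ τ) = Extreme y τ × GoodFrom y τ

extreme? : ∀ x τ → Dec (Extreme x τ)
extreme? x τ = all? (x <?_) τ ⊎-dec all? (_<? x) τ

goodFrom? : ∀ p τ → Dec (GoodFrom p τ)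
goodFrom? p []      = yes tt
goodFrom? p (y ∷ τ) = (extreme? y τ ⊎-dec p <? y) ×-dec goodFrom? y τ

good? : ∀ τ → Dec (Good τ)
good? []      = yes tt
good? (y ∷ τ) = extreme? y τ ×-dec goodFrom? y τ

Good⇒GoodFrom : ∀ p τ → Good τ → GoodFrom p τ
Good⇒GoodFrom p []      _            = tt
Good⇒GoodFrom p (y ∷ τ) (ext , good) = inj₁ ext , good

GoodFrom-max⇒Good : ∀ z τ → All (_< z) τ → GoodFrom z τ → Good τ
GoodFrom-max⇒Good z []      _           _                  = tt
GoodFrom-max⇒Good z (y ∷ τ) _           (inj₁ ext , good) = ext , good
GoodFrom-max⇒Good z (y ∷ τ) (y<z ∷ _)   (inj₂ z<y , _)    = ⊥-elim (<-asym y<z z<y)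

GoodFrom-++ : ∀ p W ρ → AllPairs _<_ (p ∷ W) → Good ρ → GoodFrom p (W ++ ρ)
GoodFrom-++ p []      ρ _                     good = Good⇒GoodFrom p ρ good
GoodFrom-++ p (w ∷ W) ρ ((p<w ∷ _) ∷ w∷W↑) good = inj₂ p<w , GoodFrom-++ w W ρ w∷W↑ good

NonExtremePrefix : List ℕ → List ℕ → Set
NonExtremePrefix []      ρ = ⊤
NonExtremePrefix (w ∷ W) ρ = ¬ Extreme w (W ++ ρ) × NonExtremePrefix W ρ

-- Cut a GoodFrom-list before its first entry that is extreme among the later ones.
decompose : ∀ y σ → GoodFrom y σ →
            ∃₂ λ W ρ → y ∷ σ ≡ W ++ ρ × AllPairs _<_ W × Good ρ × NonExtremePrefix W ρ
decompose y σ good with extreme? y σ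
... | yes ext = [] , y ∷ σ , refl , [] , (ext , good) , tt
decompose y []       good | no ¬ext = ⊥-elim (¬ext (inj₁ []))
decompose y (y′ ∷ σ) (y′-ok , good) | no ¬ext with decompose y′ σ good
... | W , ρ , eq , W↑ , ρ-good , W-nonext =
  y ∷ W , ρ , cong (y ∷_) eq , y<W W eq W↑ W-nonext y′-ok ∷ W↑ , ρ-good ,
  (λ ext → ¬ext (subst-ext eq ext)) , W-nonext
  where
  subst-ext : y′ ∷ σ ≡ W ++ ρ → Extreme y (W ++ ρ) → Extreme y (y′ ∷ σ)
  subst-ext eq ext rewrite eq = ext
  y<W : ∀ W → y′ ∷ σ ≡ W ++ ρ → AllPairs _<_ W → NonExtremePrefix W ρ →
        Extreme y′ σ ⊎ y < y′ → All (y <_) W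
  y<W []      _  _         _              _          = []
  y<W (w ∷ W) eq (w<W ∷ _) (w-nonext , _) (inj₁ ext) with refl , refl ← ∷-injective eq = ⊥-elim (w-nonext ext)
  y<W (w ∷ W) eq (w<W ∷ _) (w-nonext , _) (inj₂ y<w) with refl , refl ← ∷-injective eq =
    y<w ∷ All.map (<-trans y<w) w<W

WeaklyExtreme : ℕ → List ℕ → Set
WeaklyExtreme x τ = All (x ≤_) τ ⊎ All (_≤ x) τ

weaklyExtreme-tail : ∀ {x y τ} → WeaklyExtreme x (y ∷ τ) → WeaklyExtreme x τ
weaklyExtreme-tail (inj₁ (_ ∷ x≤τ)) = inj₁ x≤τ
weaklyExtreme-tail (inj₂ (_ ∷ τ≤x)) = inj₂ τ≤x

weaklyExtreme⇒Extreme : ∀ {x τ} → All (x ≢_) τ → WeaklyExtreme x τ → Extreme x τ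
weaklyExtreme⇒Extreme x≢τ (inj₁ x≤τ) = inj₁ (All.zipWith (uncurry ≤∧≢⇒<) (x≤τ , x≢τ))
weaklyExtreme⇒Extreme x≢τ (inj₂ τ≤x) = inj₂ (All.zipWith (uncurry (λ y≤x x≢y → ≤∧≢⇒< y≤x (x≢y ∘ sym))) (τ≤x , x≢τ))

weaklyExtreme∉NonExtremePrefix : ∀ W ρ {x} → NonExtremePrefix W ρ → Unique (W ++ ρ) →
                                 WeaklyExtreme x (W ++ ρ) → x ∉ W
weaklyExtreme∉NonExtremePrefix (w ∷ W) ρ (w-nonext , _) (w≢ ∷ _) wext (here refl) =
  w-nonext (weaklyExtreme⇒Extreme w≢ (weaklyExtreme-tail wext))
weaklyExtreme∉NonExtremePrefix (w ∷ W) ρ (_ , W-nonext) (_ ∷ W!) wext (there x∈W) =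
  weaklyExtreme∉NonExtremePrefix W ρ W-nonext W! (weaklyExtreme-tail wext) x∈W

NextBelow : ℕ → List ℕ → Set
NextBelow x []      = ⊥
NextBelow x (y ∷ _) = y < x

LastBelow : List ℕ → ℕ → Set
LastBelow []           x = ⊥
LastBelow (w ∷ [])     x = w < x
LastBelow (w ∷ w′ ∷ p) x = LastBelow (w′ ∷ p) x

Pointwise : (List ℕ → ℕ → Set) → List ℕ → Set
Pointwise Before τ = ∀ p x q → τ ≡ p ++ x ∷ q → Extreme x q ⊎ Before p x

GoodFrom⇒pointwise : ∀ y τ → GoodFrom y τ → Pointwise (λ p → LastBelow (y ∷ p)) τ
GoodFrom⇒pointwise y (z ∷ τ) (z-ok , good) []      x q eq with refl , refl ← ∷-injective eq = z-ok
GoodFrom⇒pointwise y (z ∷ τ) (_ , good)    (w ∷ p) x q eq with refl , eq′ ← ∷-injective eq =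
  GoodFrom⇒pointwise z τ good p x q eq′

pointwise⇒GoodFrom : ∀ y τ → Pointwise (λ p → LastBelow (y ∷ p)) τ → GoodFrom y τ
pointwise⇒GoodFrom y []      _  = tt
pointwise⇒GoodFrom y (z ∷ τ) ok = ok [] z τ refl , pointwise⇒GoodFrom z τ (λ p x q eq → ok (z ∷ p) x q (cong (z ∷_) eq))

Good⇔pointwise : ∀ τ → Good τ ⇔ Pointwise LastBelow τ
Good⇔pointwise τ = mk⇔ (to τ) (from τ)
  where
  to : ∀ τ → Good τ → Pointwise LastBelow τ
  to (z ∷ τ) (ext , good) []      x q eq with refl , refl ← ∷-injective eq = inj₁ ext
  to (z ∷ τ) (ext , good) (w ∷ p) x q eq with refl , eq′ ← ∷-injective eq = GoodFrom⇒pointwise z τ good p x q eq′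
  from : ∀ τ → Pointwise LastBelow τ → Good τ
  from []      _  = tt
  from (z ∷ τ) ok = [ (λ ext → ext) , (λ ()) ]′ (ok [] z τ refl) , pointwise⇒GoodFrom z τ (λ p x q eq → ok (z ∷ p) x q (cong (z ∷_) eq))
    where open Sum using ([_,_]′)

LastBelow-∷ʳ : ∀ p w x → LastBelow (p ∷ʳ w) x ≡ (w < x)
LastBelow-∷ʳ []          w x = refl
LastBelow-∷ʳ (a ∷ [])    w x = refl
LastBelow-∷ʳ (a ∷ b ∷ p) w x = LastBelow-∷ʳ (b ∷ p) w x

LastBelow-reverse : ∀ v x → LastBelow (reverse v) x ≡ NextBelow x v
LastBelow-reverse []      x = refl
LastBelow-reverse (w ∷ v) x = trans (cong (λ p → LastBelow p x) (unfold-reverse w v)) (LastBelow-∷ʳ (reverse v) w x)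

Extreme-reverse : ∀ {x} u → Extreme x (reverse u) → Extreme x u
Extreme-reverse u = Sum.map (All-resp-↭ (↭-reverse u)) (All-resp-↭ (↭-reverse u))

reverse-++-∷ : ∀ (u : List ℕ) x v → reverse (u ++ x ∷ v) ≡ reverse v ++ x ∷ reverse u
reverse-++-∷ u x v = trans (reverse-++ u (x ∷ v)) (trans (cong (_++ reverse u) (unfold-reverse x v)) (++-assoc (reverse v) [ x ] (reverse u)))

EntrywiseGood : List ℕ → Set
EntrywiseGood π = ∀ u x v → π ≡ u ++ x ∷ v → Extreme x u ⊎ NextBelow x v

Good-reverse⇔EntrywiseGood : ∀ π → Good (reverse π) ⇔ EntrywiseGood π
Good-reverse⇔EntrywiseGood π = mk⇔ to from
  where
  to : Good (reverse π) → EntrywiseGood π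
  to good u x v eq =
    Sum.map (Extreme-reverse u) (subst (λ A → A) (LastBelow-reverse v x))
      (Equivalence.to (Good⇔pointwise (reverse π)) good (reverse v) x (reverse u) (trans (cong reverse eq) (reverse-++-∷ u x v)))
  from : EntrywiseGood π → Good (reverse π)
  from ok = Equivalence.from (Good⇔pointwise (reverse π)) λ p x q eq →
    Sum.map (Extreme-reverse q)
            (subst (λ A → A) (sym (trans (cong (λ r → LastBelow r x) (sym (reverse-involutive p))) (LastBelow-reverse (reverse p) x))))
      (ok (reverse q) x (reverse p) (trans (sym (reverse-involutive π)) (trans (cong reverse eq) (reverse-++-∷ p x q))))

module _ {A : Set} where

  open Interleaving {A = A} using (Interleaving; []; consˡ; consʳ; toPermutation)


  interleavings : List A → List (List A × List A)
  interleavings []       = ([] , []) ∷ []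
  interleavings (x ∷ xs) = map (λ (l , r) → x ∷ l , r) (interleavings xs) ++ map (λ (l , r) → l , x ∷ r) (interleavings xs)

  ∈-interleavings⁻ : ∀ xs {l r} → (l , r) ∈ interleavings xs → Interleaving l r xs
  ∈-interleavings⁻ []       (here refl) = []
  ∈-interleavings⁻ (x ∷ xs) lr∈ with ∈-++⁻ (map (λ (l , r) → x ∷ l , r) (interleavings xs)) lr∈
  ... | inj₁ lr∈ˡ with ∈-map⁻ (λ (l , r) → x ∷ l , r) lr∈ˡ
  ...   | _ , lr∈′ , refl = consˡ (∈-interleavings⁻ xs lr∈′)
  ∈-interleavings⁻ (x ∷ xs) lr∈ | inj₂ lr∈ʳ with ∈-map⁻ (λ (l , r) → l , x ∷ r) lr∈ʳ
  ...   | _ , lr∈′ , refl = consʳ (∈-interleavings⁻ xs lr∈′)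

  ∈-interleavings⁺ : ∀ {xs l r} → Interleaving l r xs → (l , r) ∈ interleavings xs
  ∈-interleavings⁺ []                         = here refl
  ∈-interleavings⁺ {x ∷ xs} (consˡ sp) = ∈-++⁺ˡ (∈-map⁺ (λ (l , r) → x ∷ l , r) (∈-interleavings⁺ sp))
  ∈-interleavings⁺ {x ∷ xs} (consʳ sp) =
    ∈-++⁺ʳ (map (λ (l , r) → x ∷ l , r) (interleavings xs)) (∈-map⁺ (λ (l , r) → l , x ∷ r) (∈-interleavings⁺ sp))

  ∈-interleavingˡ : ∀ {l r xs y} → Interleaving l r xs → y ∈ l → y ∈ xs
  ∈-interleavingˡ sp y∈l = ∈-resp-↭ (↭-sym (toPermutation sp)) (∈-++⁺ˡ y∈l)

  ∈-interleavingʳ : ∀ {l r xs y} → Interleaving l r xs → y ∈ r → y ∈ xs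
  ∈-interleavingʳ {l} sp y∈r = ∈-resp-↭ (↭-sym (toPermutation sp)) (∈-++⁺ʳ l y∈r)

  interleavings-unique : ∀ {xs} → Unique xs → Unique (interleavings xs)
  interleavings-unique {[]}     _            = [] ∷ []
  interleavings-unique {x ∷ xs} (x≢xs ∷ xs!) =
    Unique.++⁺ (Unique.map⁺ injˡ (interleavings-unique xs!)) (Unique.map⁺ injʳ (interleavings-unique xs!)) disjoint
    where
    injˡ : ∀ {p q : List A × List A} → (x ∷ proj₁ p , proj₂ p) ≡ (x ∷ proj₁ q , proj₂ q) → p ≡ q
    injˡ refl = refl
    injʳ : ∀ {p q : List A × List A} → (proj₁ p , x ∷ proj₂ p) ≡ (proj₁ q , x ∷ proj₂ q) → p ≡ q
    injʳ refl = refl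
    disjoint : ∀ {lr} → lr ∈ map (λ (l , r) → x ∷ l , r) (interleavings xs) × lr ∈ map (λ (l , r) → l , x ∷ r) (interleavings xs) → ⊥
    disjoint (lr∈ˡ , lr∈ʳ) with ∈-map⁻ (λ (l , r) → x ∷ l , r) lr∈ˡ | ∈-map⁻ (λ (l , r) → l , x ∷ r) lr∈ʳ
    ... | _ , _ , refl | _ , lr∈ , refl = All.lookup x≢xs (∈-interleavingˡ (∈-interleavings⁻ xs lr∈) (here refl)) refl

  interleaving-AllPairsˡ : ∀ {ℓ} {R : Rel A ℓ} {l r xs} → AllPairs R xs → Interleaving l r xs → AllPairs R l
  interleaving-AllPairsˡ []           []          = []
  interleaving-AllPairsˡ (Rx ∷ xs-R)  (consˡ sp)  =
    All.tabulate (All.lookup Rx ∘ ∈-interleavingˡ sp) ∷ interleaving-AllPairsˡ xs-R sp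
  interleaving-AllPairsˡ (_ ∷ xs-R)   (consʳ sp)  = interleaving-AllPairsˡ xs-R sp

  interleaving-AllPairsʳ : ∀ {ℓ} {R : Rel A ℓ} {l r xs} → AllPairs R xs → Interleaving l r xs → AllPairs R r
  interleaving-AllPairsʳ []           []          = []
  interleaving-AllPairsʳ (_ ∷ xs-R)   (consˡ sp)  = interleaving-AllPairsʳ xs-R sp
  interleaving-AllPairsʳ (Rx ∷ xs-R)  (consʳ sp)  =
    All.tabulate (All.lookup Rx ∘ ∈-interleavingʳ sp) ∷ interleaving-AllPairsʳ xs-R sp

  interleaving-determined : ∀ {l r r′ xs} → Unique xs → Interleaving l r xs → Interleaving l r′ xs → r ≡ r′
  interleaving-determined _            []          []          = refl
  interleaving-determined (_ ∷ xs!)    (consˡ sp)  (consˡ sp′) = interleaving-determined xs! sp sp′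
  interleaving-determined (_ ∷ xs!)    (consʳ sp)  (consʳ sp′) = cong (_ ∷_) (interleaving-determined xs! sp sp′)
  interleaving-determined (x≢xs ∷ _)   (consˡ sp)  (consʳ sp′) = ⊥-elim (All.lookup x≢xs (∈-interleavingˡ sp′ (here refl)) refl)
  interleaving-determined (x≢xs ∷ _)   (consʳ sp)  (consˡ sp′) = ⊥-elim (All.lookup x≢xs (∈-interleavingˡ sp (here refl)) refl)

open Interleaving {A = ℕ} using (Interleaving; []; consˡ; consʳ; toPermutation)

sum-interleavings : ∀ (g : ℕ → ℕ) (xs : List ℕ) →
                    sum (map (g ∘ length ∘ proj₂) (interleavings xs)) ≡ binomialTransform g (length xs)
sum-interleavings g []       = +-identityʳ (g 0)
sum-interleavings g (x ∷ xs) = begin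
  sum (map (g ∘ length ∘ proj₂) (map (λ (l , r) → x ∷ l , r) I ++ map (λ (l , r) → l , x ∷ r) I))
    ≡⟨ cong sum (map-++ (g ∘ length ∘ proj₂) (map (λ (l , r) → x ∷ l , r) I) _) ⟩
  sum (map (g ∘ length ∘ proj₂) (map (λ (l , r) → x ∷ l , r) I) ++ map (g ∘ length ∘ proj₂) (map (λ (l , r) → l , x ∷ r) I))
    ≡⟨ sum-++ (map (g ∘ length ∘ proj₂) (map (λ (l , r) → x ∷ l , r) I)) _ ⟩
  sum (map (g ∘ length ∘ proj₂) (map (λ (l , r) → x ∷ l , r) I)) + sum (map (g ∘ length ∘ proj₂) (map (λ (l , r) → l , x ∷ r) I))
    ≡⟨ cong₂ _+_ (cong sum (sym (map-∘ I))) (cong sum (sym (map-∘ I))) ⟩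
  sum (map (g ∘ length ∘ proj₂) I) + sum (map (g ∘ suc ∘ length ∘ proj₂) I)
    ≡⟨ cong₂ _+_ (sum-interleavings g xs) (sum-interleavings (g ∘ suc) xs) ⟩
  binomialTransform g (length xs) + binomialTransform (g ∘ suc) (length xs) ∎
  where
  open ≡-Reasoning
  I = interleavings xs

interleaving-exists : ∀ {xs l} → AllPairs _<_ xs → AllPairs _<_ l → (∀ {y} → y ∈ l → y ∈ xs) →
                      ∃ λ r → Interleaving l r xs
interleaving-exists {[]}     {[]}    _ _ _ = [] , []
interleaving-exists {[]}     {_ ∷ _} _ _ l⊆ with () ← l⊆ (here refl)
interleaving-exists {x ∷ xs} {[]}    (_ ∷ xs↑) _ _ =
  let r , sp = interleaving-exists xs↑ [] (λ ()) in x ∷ r , consʳ sp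
interleaving-exists {x ∷ xs} {w ∷ l} (x<xs ∷ xs↑) (w<l ∷ l↑) l⊆ with w ≟ x
... | yes refl = let r , sp = interleaving-exists xs↑ l↑ l′⊆xs in r , consˡ sp
  where
  l′⊆xs : ∀ {y} → y ∈ l → y ∈ xs
  l′⊆xs y∈l with l⊆ (there y∈l)
  ... | here refl = ⊥-elim (<-irrefl refl (All.lookup w<l y∈l))
  ... | there y∈xs = y∈xs
... | no w≢x = let r , sp = interleaving-exists xs↑ (w<l ∷ l↑) w∷l⊆xs in x ∷ r , consʳ sp
  where
  w∈xs : w ∈ xs
  w∈xs with l⊆ (here refl)
  ... | here w≡x = ⊥-elim (w≢x w≡x)
  ... | there w∈xs = w∈xs
  w∷l⊆xs : ∀ {y} → y ∈ w ∷ l → y ∈ xs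
  w∷l⊆xs (here refl) = w∈xs
  w∷l⊆xs (there y∈l) with l⊆ (there y∈l)
  ... | here refl = ⊥-elim (<-asym (All.lookup x<xs w∈xs) (All.lookup w<l y∈l))
  ... | there y∈xs = y∈xs


AllPairs-∷ʳ⁻ : ∀ {xs z} → AllPairs _<_ (xs ∷ʳ z) → AllPairs _<_ xs × All (_< z) xs
AllPairs-∷ʳ⁻ {[]}     _            = [] , []
AllPairs-∷ʳ⁻ {x ∷ xs} (x< ∷ xs↑) =
  let xs↑′ , xs<z = AllPairs-∷ʳ⁻ xs↑ in
  All.++⁻ˡ xs x< ∷ xs↑′ , All.lookup x< (∈-++⁺ʳ xs (here refl)) ∷ xs<z

AllPairs-∷ʳ⁺ : ∀ {xs z} → AllPairs _<_ xs → All (_< z) xs → AllPairs _<_ (xs ∷ʳ z)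
AllPairs-∷ʳ⁺ xs↑ xs<z = AllPairs.++⁺ xs↑ ([] ∷ []) (All.map (_∷ []) xs<z)

record Ordered (a b : ℕ) (M : List ℕ) (z : ℕ) : Set where
  field
    a<b : a < b
    b<M : All (b <_) M
    M<z : All (_< z) M
    b<z : b < z
    M↑  : AllPairs _<_ M

  a<M : All (a <_) M
  a<M = All.map (<-trans a<b) b<M

  a<z : a < z
  a<z = <-trans a<b b<z

  b∷M∷ʳz↑ : AllPairs _<_ (b ∷ M ∷ʳ z)
  b∷M∷ʳz↑ = All.++⁺ b<M (b<z ∷ []) ∷ AllPairs-∷ʳ⁺ M↑ M<z

ordered : ∀ {a b M z} → AllPairs _<_ (a ∷ b ∷ M ∷ʳ z) → Ordered a b M z
ordered {M = M} (a< ∷ b< ∷ M∷ʳz↑) = record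
  { a<b = All.lookup a< (here refl)
  ; b<M = All.++⁻ˡ M b<
  ; M<z = proj₂ (AllPairs-∷ʳ⁻ M∷ʳz↑)
  ; b<z = All.lookup b< (∈-++⁺ʳ M (here refl))
  ; M↑  = proj₁ (AllPairs-∷ʳ⁻ M∷ʳz↑)
  }

minFirst : (List ℕ → List (List ℕ)) → ℕ → ℕ → ℕ → List ℕ × List ℕ → List (List ℕ)
minFirst gen a b z (W , U) = map (λ ρ → a ∷ W ++ ρ) (gen (b ∷ U ∷ʳ z))

-- goodReversals k X lists the reversals of the good arrangements of an increasing X,
-- provided length X ≤ k: with a < b the two least and z the largest entry, such a reversal
-- starts either with z or with a followed by an increasing run W of middle entries.
goodReversals : ℕ → List ℕ → List (List ℕ)
goodReversals k       []           = [ [] ]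
goodReversals k       (a ∷ [])     = [ a ∷ [] ]
goodReversals zero    (a ∷ b ∷ xs) = []
goodReversals (suc k) (a ∷ b ∷ xs) with reverseView xs
... | []          = (b ∷ a ∷ []) ∷ (a ∷ b ∷ []) ∷ []
... | M ∶ _ ∶ʳ z = map (z ∷_) (goodReversals k (a ∷ b ∷ M)) ++ concatMap (minFirst (goodReversals k) a b z) (interleavings M)

length-∷ʳ : ∀ {A : Set} (xs : List A) x → length (xs ∷ʳ x) ≡ suc (length xs)
length-∷ʳ []       x = refl
length-∷ʳ (_ ∷ xs) x = cong suc (length-∷ʳ xs x)

fuel-init : ∀ {k} (a b : ℕ) M z → length (a ∷ b ∷ M ∷ʳ z) ≤ suc k → length (a ∷ b ∷ M) ≤ k
fuel-init {k} a b M z ℓ≤ with s≤s ℓ≤′ ← subst (_≤ suc k) (cong (suc ∘ suc) (length-∷ʳ M z)) ℓ≤ = ℓ≤′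

fuel-minFirst : ∀ {k} (a b : ℕ) {z W U M} → Interleaving W U M → length (a ∷ b ∷ M ∷ʳ z) ≤ suc k → length (b ∷ U ∷ʳ z) ≤ k
fuel-minFirst {k} a b {z} {W} {U} {M} sp ℓ≤ = begin
  length (b ∷ U ∷ʳ z) ≡⟨ cong suc (length-∷ʳ U z) ⟩
  suc (suc (length U)) ≤⟨ s≤s (s≤s (subst (length U ≤_) (sym (trans (↭-length (toPermutation sp)) (length-++ W))) (m≤n+m _ (length W)))) ⟩
  length (a ∷ b ∷ M)   ≤⟨ fuel-init a b M z ℓ≤ ⟩
  k ∎
  where open Data.Nat.Properties.≤-Reasoning

↭-++-cancelˡ : ∀ (ws : List ℕ) {xs ys} → ws ++ xs ↭ ws ++ ys → xs ↭ ys
↭-++-cancelˡ []       p = p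
↭-++-cancelˡ (w ∷ ws) p = ↭-++-cancelˡ ws (drop-∷ p)

head-min : ∀ {x τ xs m} → x ∷ τ ↭ xs → m ∈ xs → All (m ≤_) xs → All (x <_) τ → x ≡ m
head-min p m∈ m≤ x<τ with ∈-resp-↭ (↭-sym p) m∈
... | here x≡m  = sym x≡m
... | there m∈τ = ⊥-elim (<-irrefl refl (<-≤-trans (All.lookup x<τ m∈τ) (All.lookup m≤ (∈-resp-↭ p (here refl)))))

head-max : ∀ {x τ xs m} → x ∷ τ ↭ xs → m ∈ xs → All (_≤ m) xs → All (_< x) τ → x ≡ m
head-max p m∈ ≤m τ<x with ∈-resp-↭ (↭-sym p) m∈
... | here x≡m  = sym x≡m
... | there m∈τ = ⊥-elim (<-irrefl refl (<-≤-trans (All.lookup τ<x m∈τ) (All.lookup ≤m (∈-resp-↭ p (here refl)))))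

≤-last : ∀ xs {z} → AllPairs _<_ (xs ∷ʳ z) → All (_≤ z) (xs ∷ʳ z)
≤-last xs xs∷ʳz↑ = All.++⁺ (All.map <⇒≤ (proj₂ (AllPairs-∷ʳ⁻ xs∷ʳz↑))) (≤-refl ∷ [])

extreme-head : ∀ {x τ a Y z} → AllPairs _<_ (a ∷ Y ∷ʳ z) → x ∷ τ ↭ a ∷ Y ∷ʳ z → Extreme x τ →
               (x ≡ a × τ ↭ Y ∷ʳ z) ⊎ (x ≡ z × τ ↭ a ∷ Y)
extreme-head {x} {τ} {a} {Y} {z} X↑@(a< ∷ _) p (inj₁ x<τ) with refl ← head-min p (here refl) (≤-refl ∷ All.map <⇒≤ a<) x<τ =
  inj₁ (refl , drop-∷ p)
extreme-head {x} {τ} {a} {Y} {z} X↑ p (inj₂ τ<x) with refl ← head-max p (∈-++⁺ʳ (a ∷ Y) (here refl)) (≤-last (a ∷ Y) X↑) τ<x =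
  inj₂ (refl , drop-∷ (↭-trans p (++-comm (a ∷ Y) [ z ])))

minFirst-↭ : ∀ {b z W U M} → Interleaving W U M → W ++ (b ∷ U ∷ʳ z) ↭ b ∷ M ∷ʳ z
minFirst-↭ {b} {z} {W} {U} {M} sp = begin
  W ++ [ b ] ++ U ∷ʳ z ↭⟨ shift b W (U ∷ʳ z) ⟩
  b ∷ W ++ U ++ [ z ]  ≡⟨ cong (b ∷_) (sym (++-assoc W U [ z ])) ⟩
  b ∷ (W ++ U) ∷ʳ z    ↭⟨ ↭-prep b (++⁺ʳ [ z ] (↭-sym (toPermutation sp))) ⟩
  b ∷ M ∷ʳ z           ∎
  where open PermutationReasoning

module _ {a b M z} (X↑ : AllPairs _<_ (a ∷ b ∷ M ∷ʳ z)) where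
  open Ordered (ordered X↑)

  a∷b∷M↑ : AllPairs _<_ (a ∷ b ∷ M)
  a∷b∷M↑ = (a<b ∷ a<M) ∷ b<M ∷ M↑

  minFirst-increasing : ∀ {W U} → Interleaving W U M → AllPairs _<_ (b ∷ U ∷ʳ z)
  minFirst-increasing sp =
    All.++⁺ (All.tabulate (All.lookup b<M ∘ ∈-interleavingʳ sp)) (b<z ∷ []) ∷
    AllPairs-∷ʳ⁺ (interleaving-AllPairsʳ M↑ sp) (All.tabulate (All.lookup M<z ∘ ∈-interleavingʳ sp))

  maxFirst-sound : ∀ {τ} → τ ↭ a ∷ b ∷ M → Good τ → z ∷ τ ↭ a ∷ b ∷ M ∷ʳ z × Good (z ∷ τ)
  maxFirst-sound {τ} p good =
    ↭-trans (↭-prep z p) (++-comm [ z ] (a ∷ b ∷ M)) ,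
    inj₂ (All-resp-↭ (↭-sym p) (a<z ∷ b<z ∷ M<z)) , Good⇒GoodFrom z τ good

  minFirst-sound : ∀ {W U ρ} → Interleaving W U M → ρ ↭ b ∷ U ∷ʳ z → Good ρ →
                   a ∷ W ++ ρ ↭ a ∷ b ∷ M ∷ʳ z × Good (a ∷ W ++ ρ)
  minFirst-sound {W} {U} {ρ} sp p good =
    ↭-prep a W++ρ↭ ,
    inj₁ (All-resp-↭ (↭-sym W++ρ↭) (a<b ∷ All.++⁺ a<M (a<z ∷ []))) ,
    GoodFrom-++ a W ρ (All.tabulate (All.lookup a<M ∘ ∈-interleavingˡ sp) ∷ interleaving-AllPairsˡ M↑ sp) good
    where
    W++ρ↭ : W ++ ρ ↭ b ∷ M ∷ʳ z
    W++ρ↭ = ↭-trans (++⁺ˡ W p) (minFirst-↭ sp)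

  minFirst-complete : ∀ {τ} → τ ↭ b ∷ M ∷ʳ z → GoodFrom a τ →
                      ∃₂ λ W ρ → τ ≡ W ++ ρ × ∃ λ U → Interleaving W U M × ρ ↭ b ∷ U ∷ʳ z × Good ρ
  minFirst-complete {[]}    p _ with () ← ∈-resp-↭ (↭-sym p) (here refl)
  minFirst-complete {y ∷ σ} p (_ , good) with decompose y σ good
  ... | W , ρ , eq , W↑ , ρ-good , W-nonext =
    W , ρ , eq , U , sp , ↭-++-cancelˡ W (↭-trans p′ (↭-sym (minFirst-↭ sp))) , ρ-good
    where
    p′ : W ++ ρ ↭ b ∷ M ∷ʳ z
    p′ = subst (_↭ b ∷ M ∷ʳ z) eq p
    W++ρ! : Unique (W ++ ρ)
    W++ρ! = ↭-unique p′ (increasing⇒unique b∷M∷ʳz↑)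
    b∉W : b ∉ W
    b∉W = weaklyExtreme∉NonExtremePrefix W ρ W-nonext W++ρ!
            (inj₁ (All-resp-↭ (↭-sym p′) (≤-refl ∷ All.map <⇒≤ (All.++⁺ b<M (b<z ∷ [])))))
    z∉W : z ∉ W
    z∉W = weaklyExtreme∉NonExtremePrefix W ρ W-nonext W++ρ!
            (inj₂ (All-resp-↭ (↭-sym p′) (≤-last (b ∷ M) b∷M∷ʳz↑)))
    W⊆M : ∀ {w} → w ∈ W → w ∈ M
    W⊆M w∈W with ∈-resp-↭ p′ (∈-++⁺ˡ w∈W)
    ... | here refl = ⊥-elim (b∉W w∈W)
    ... | there w∈ with ∈-++⁻ M w∈
    ...   | inj₁ w∈M         = w∈M
    ...   | inj₂ (here refl) = ⊥-elim (z∉W w∈W)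
    U  = proj₁ (interleaving-exists M↑ W↑ W⊆M)
    sp = proj₂ (interleaving-exists M↑ W↑ W⊆M)

goodReversals-sound : ∀ k X {τ} → length X ≤ k → AllPairs _<_ X → τ ∈ goodReversals k X → τ ↭ X × Good τ
goodReversals-sound k       []           _  _  (here refl) = ↭-refl , tt
goodReversals-sound k       (a ∷ [])     _  _  (here refl) = ↭-refl , inj₁ [] , tt
goodReversals-sound (suc k) (a ∷ b ∷ xs) ℓ≤ X↑ τ∈ with reverseView xs
goodReversals-sound (suc k) (a ∷ b ∷ xs) ℓ≤ ((a<b ∷ []) ∷ _) (here refl) | [] =
  ↭-swap b a ↭-refl , inj₂ (a<b ∷ []) , inj₁ (inj₁ []) , tt
goodReversals-sound (suc k) (a ∷ b ∷ xs) ℓ≤ ((a<b ∷ []) ∷ _) (there (here refl)) | [] =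
  ↭-refl , inj₁ (a<b ∷ []) , inj₁ (inj₁ []) , tt
goodReversals-sound (suc k) (a ∷ b ∷ xs) ℓ≤ X↑ τ∈ | M ∶ _ ∶ʳ z
  with ∈-++⁻ (map (z ∷_) (goodReversals k (a ∷ b ∷ M))) τ∈
... | inj₁ τ∈ˡ with ∈-map⁻ (z ∷_) τ∈ˡ
...   | τ , τ∈′ , refl = uncurry (maxFirst-sound X↑) (goodReversals-sound k (a ∷ b ∷ M) (fuel-init a b M z ℓ≤) (a∷b∷M↑ X↑) τ∈′)
goodReversals-sound (suc k) (a ∷ b ∷ xs) ℓ≤ X↑ τ∈ | M ∶ _ ∶ʳ z | inj₂ τ∈ʳ
  with find (∈-concatMap⁻ (minFirst (goodReversals k) a b z) {xs = interleavings M} τ∈ʳ)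
... | (W , U) , WC∈ , τ∈′ with ∈-map⁻ (λ ρ → a ∷ W ++ ρ) τ∈′
...   | ρ , ρ∈ , refl =
  let sp = ∈-interleavings⁻ M WC∈ in
  uncurry (minFirst-sound X↑ sp) (goodReversals-sound k (b ∷ U ∷ʳ z) (fuel-minFirst a b sp ℓ≤) (minFirst-increasing X↑ sp) ρ∈)

goodReversals-complete : ∀ k X {τ} → length X ≤ k → AllPairs _<_ X → τ ↭ X → Good τ → τ ∈ goodReversals k X
goodReversals-complete k       []       _  _  p _ with refl ← ↭-empty-inv p = here refl
goodReversals-complete k       (a ∷ []) _  _  p _ with refl ← ↭-singleton-inv p = here refl
goodReversals-complete (suc k) (a ∷ b ∷ xs) {[]} _ _ p _ with () ← ↭-empty-inv (↭-sym p)
goodReversals-complete (suc k) (a ∷ b ∷ xs) {x ∷ τ} ℓ≤ X↑ p (ext , good) with reverseView xs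
... | [] with extreme-head {Y = []} X↑ p ext
...   | inj₁ (refl , p′) with refl ← ↭-singleton-inv p′ = there (here refl)
...   | inj₂ (refl , p′) with refl ← ↭-singleton-inv p′ = here refl
goodReversals-complete (suc k) (a ∷ b ∷ xs) {x ∷ τ} ℓ≤ X↑ p (ext , good) | M ∶ _ ∶ʳ z with extreme-head {Y = b ∷ M} X↑ p ext
... | inj₂ (refl , p′) =
  ∈-++⁺ˡ (∈-map⁺ (z ∷_) (goodReversals-complete k (a ∷ b ∷ M) (fuel-init a b M z ℓ≤) (a∷b∷M↑ X↑) p′
           (GoodFrom-max⇒Good z τ (All-resp-↭ (↭-sym p′) (a<z ∷ b<z ∷ M<z)) good)))
  where open Ordered (ordered X↑)
... | inj₁ (refl , p′) with minFirst-complete X↑ p′ good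
...   | W , ρ , refl , U , sp , ρ↭ , ρ-good =
  ∈-++⁺ʳ (map (z ∷_) (goodReversals k (a ∷ b ∷ M)))
    (∈-concatMap⁺ (minFirst (goodReversals k) a b z) {xs = interleavings M}
      (lose (∈-interleavings⁺ sp)
        (∈-map⁺ (λ ρ → a ∷ W ++ ρ) (goodReversals-complete k (b ∷ U ∷ʳ z) (fuel-minFirst a b sp ℓ≤) (minFirst-increasing X↑ sp) ρ↭ ρ-good))))

++-∷-prefix-unique : ∀ {A : Set} {P : A → Set} W W′ {h h′ : A} {ρ ρ′} → All P W → All P W′ → ¬ P h → ¬ P h′ →
                     W ++ h ∷ ρ ≡ W′ ++ h′ ∷ ρ′ → W ≡ W′
++-∷-prefix-unique []      []       _          _           _    _     _  = refl
++-∷-prefix-unique []      (w′ ∷ _) _          (Pw′ ∷ _)   ¬Ph  _     eq with refl , _ ← ∷-injective eq = ⊥-elim (¬Ph Pw′)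
++-∷-prefix-unique (w ∷ _) []       (Pw ∷ _)   _           _    ¬Ph′  eq with refl , _ ← ∷-injective eq = ⊥-elim (¬Ph′ Pw)
++-∷-prefix-unique (w ∷ W) (_ ∷ W′) (_ ∷ PW)   (_ ∷ PW′)   ¬Ph  ¬Ph′  eq with refl , eq′ ← ∷-injective eq =
  cong (w ∷_) (++-∷-prefix-unique W W′ PW PW′ ¬Ph ¬Ph′ eq′)

module _ {a b M z} (X↑ : AllPairs _<_ (a ∷ b ∷ M ∷ʳ z)) where
  open Ordered (ordered X↑)

  minFirst-head : ∀ {W U ρ} → Interleaving W U M → ρ ↭ b ∷ U ∷ʳ z → Good ρ → ∃₂ λ h ρ′ → ρ ≡ h ∷ ρ′ × h ∉ M
  minFirst-head {ρ = []}    _  p _          with () ← ↭-empty-inv (↭-sym p)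
  minFirst-head {ρ = h ∷ ρ} sp p (ext , _) with extreme-head (minFirst-increasing X↑ sp) p ext
  ... | inj₁ (refl , _) = h , ρ , refl , λ b∈M → <-irrefl refl (All.lookup b<M b∈M)
  ... | inj₂ (refl , _) = h , ρ , refl , λ z∈M → <-irrefl refl (All.lookup M<z z∈M)

  minFirst-injective : ∀ {W U W′ U′ ρ ρ′} → Interleaving W U M → Interleaving W′ U′ M →
                       ρ ↭ b ∷ U ∷ʳ z → Good ρ → ρ′ ↭ b ∷ U′ ∷ʳ z → Good ρ′ →
                       W ++ ρ ≡ W′ ++ ρ′ → (W , U) ≡ (W′ , U′)
  minFirst-injective {W} {U} {W′} sp sp′ p good p′ good′ eq
    with minFirst-head sp p good | minFirst-head sp′ p′ good′
  ... | h , _ , refl , h∉M | h′ , _ , refl , h′∉M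
    with refl ← ++-∷-prefix-unique W W′ (All.tabulate (∈-interleavingˡ sp)) (All.tabulate (∈-interleavingˡ sp′)) h∉M h′∉M eq =
    cong (W ,_) (interleaving-determined (increasing⇒unique M↑) sp sp′)

goodReversals-unique : ∀ k X → length X ≤ k → AllPairs _<_ X → Unique (goodReversals k X)
goodReversals-unique k       []           _  _  = [] ∷ []
goodReversals-unique k       (a ∷ [])     _  _  = [] ∷ []
goodReversals-unique (suc k) (a ∷ b ∷ xs) ℓ≤ X↑ with reverseView xs
goodReversals-unique (suc k) (a ∷ b ∷ xs) ℓ≤ ((a<b ∷ []) ∷ _) | [] =
  ((λ eq → <-irrefl (sym (proj₁ (∷-injective eq))) a<b) ∷ []) ∷ [] ∷ []
goodReversals-unique (suc k) (a ∷ b ∷ xs) ℓ≤ X↑ | M ∶ _ ∶ʳ z =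
  Unique.++⁺ (Unique.map⁺ (proj₂ ∘ ∷-injective) (goodReversals-unique k (a ∷ b ∷ M) (fuel-init a b M z ℓ≤) (a∷b∷M↑ X↑)))
             (concatMap-unique (minFirst (goodReversals k) a b z) (interleavings-unique (increasing⇒unique M↑)) piece! piece-injective)
             heads-differ
  where
  open Ordered (ordered X↑)
  sound : ∀ {W U ρ} → Interleaving W U M → ρ ∈ goodReversals k (b ∷ U ∷ʳ z) → ρ ↭ b ∷ U ∷ʳ z × Good ρ
  sound {U = U} sp = goodReversals-sound k (b ∷ U ∷ʳ z) (fuel-minFirst a b sp ℓ≤) (minFirst-increasing X↑ sp)
  piece! : ∀ {WC} → WC ∈ interleavings M → Unique (minFirst (goodReversals k) a b z WC)
  piece! {W , U} WC∈ =
    Unique.map⁺ (++-cancelˡ W _ _ ∘ proj₂ ∘ ∷-injective)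
      (goodReversals-unique k (b ∷ U ∷ʳ z) (fuel-minFirst a b sp ℓ≤) (minFirst-increasing X↑ sp))
    where sp = ∈-interleavings⁻ M WC∈
  piece-injective : ∀ {WC WC′ τ} → WC ∈ interleavings M → WC′ ∈ interleavings M →
                    τ ∈ minFirst (goodReversals k) a b z WC → τ ∈ minFirst (goodReversals k) a b z WC′ → WC ≡ WC′
  piece-injective {W , U} {W′ , U′} WC∈ WC′∈ τ∈ τ∈′
    with ∈-map⁻ (λ ρ → a ∷ W ++ ρ) τ∈ | ∈-map⁻ (λ ρ → a ∷ W′ ++ ρ) τ∈′
  ... | ρ , ρ∈ , refl | ρ′ , ρ′∈ , eq =
    let sp = ∈-interleavings⁻ M WC∈ ; sp′ = ∈-interleavings⁻ M WC′∈ in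
    uncurry (uncurry (minFirst-injective X↑ sp sp′) (sound sp ρ∈)) (sound sp′ ρ′∈) (proj₂ (∷-injective eq))
  heads-differ : ∀ {τ} → τ ∈ map (z ∷_) (goodReversals k (a ∷ b ∷ M)) × τ ∈ concatMap (minFirst (goodReversals k) a b z) (interleavings M) → ⊥
  heads-differ (τ∈ˡ , τ∈ʳ) with ∈-map⁻ (z ∷_) τ∈ˡ | find (∈-concatMap⁻ (minFirst (goodReversals k) a b z) {xs = interleavings M} τ∈ʳ)
  ... | _ , _ , refl | (W , U) , _ , τ∈′ with ∈-map⁻ (λ ρ → a ∷ W ++ ρ) τ∈′
  ...   | _ , _ , eq = <-irrefl (sym (proj₁ (∷-injective eq))) a<z

goodCount : ℕ → ℕ
goodCount zero          = 1
goodCount (suc zero)    = 1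
goodCount (suc (suc m)) = 2 * Bell (suc m)

Bell-suc-suc : ∀ m → Bell (suc (suc m)) ≡ Bell (suc m) + binomialTransform (Bell ∘ suc) m
Bell-suc-suc m = trans (Bell-suc (suc m)) (cong (_+ binomialTransform (Bell ∘ suc) m) (sym (Bell-suc m)))

goodCount-suc : ∀ m → goodCount (3 + m) ≡ goodCount (2 + m) + binomialTransform (goodCount ∘ (2 +_)) m
goodCount-suc m = begin
  2 * Bell (2 + m)                                                  ≡⟨ cong (2 *_) (Bell-suc-suc m) ⟩
  2 * (Bell (1 + m) + binomialTransform (Bell ∘ suc) m)             ≡⟨ *-distribˡ-+ 2 (Bell (1 + m)) _ ⟩
  2 * Bell (1 + m) + 2 * binomialTransform (Bell ∘ suc) m           ≡⟨ cong (2 * Bell (1 + m) +_) (sym (binomialTransform-* 2 (Bell ∘ suc) m)) ⟩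
  2 * Bell (1 + m) + binomialTransform (λ j → 2 * Bell (suc j)) m ∎
  where open ≡-Reasoning

length-concatMap : ∀ {A B : Set} (f : A → List B) xs → length (concatMap f xs) ≡ sum (map (length ∘ f) xs)
length-concatMap f []       = refl
length-concatMap f (x ∷ xs) = trans (length-++ (f x)) (cong (length (f x) +_) (length-concatMap f xs))

length-goodReversals : ∀ k X → length X ≤ k → AllPairs _<_ X → length (goodReversals k X) ≡ goodCount (length X)
length-goodReversals k       []           _  _  = refl
length-goodReversals k       (a ∷ [])     _  _  = refl
length-goodReversals (suc k) (a ∷ b ∷ xs) ℓ≤ X↑ with reverseView xs
... | []          = refl
... | M ∶ _ ∶ʳ z = begin
  length (map (z ∷_) G ++ concatMap (minFirst (goodReversals k) a b z) I)
    ≡⟨ length-++ (map (z ∷_) G) ⟩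
  length (map (z ∷_) G) + length (concatMap (minFirst (goodReversals k) a b z) I)
    ≡⟨ cong₂ _+_ (trans (length-map (z ∷_) G) (length-goodReversals k (a ∷ b ∷ M) (fuel-init a b M z ℓ≤) (a∷b∷M↑ X↑)))
                 (length-concatMap (minFirst (goodReversals k) a b z) I) ⟩
  goodCount (2 + length M) + sum (map (length ∘ minFirst (goodReversals k) a b z) I)
    ≡⟨ cong (λ xs → goodCount (2 + length M) + sum xs) (map-cong-local (All.tabulate length-piece)) ⟩
  goodCount (2 + length M) + sum (map (goodCount ∘ (2 +_) ∘ length ∘ proj₂) I)
    ≡⟨ cong (goodCount (2 + length M) +_) (sum-interleavings (goodCount ∘ (2 +_)) M) ⟩
  goodCount (2 + length M) + binomialTransform (goodCount ∘ (2 +_)) (length M)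
    ≡⟨ goodCount-suc (length M) ⟨
  goodCount (3 + length M)
    ≡⟨ cong (goodCount ∘ (2 +_)) (length-∷ʳ M z) ⟨
  goodCount (length (a ∷ b ∷ M ∷ʳ z)) ∎
  where
  open ≡-Reasoning
  G = goodReversals k (a ∷ b ∷ M)
  I = interleavings M
  length-piece : ∀ {WC} → WC ∈ I → length (minFirst (goodReversals k) a b z WC) ≡ goodCount (2 + length (proj₂ WC))
  length-piece {W , U} WC∈ =
    let sp = ∈-interleavings⁻ M WC∈ in
    trans (length-map (λ ρ → a ∷ W ++ ρ) (goodReversals k (b ∷ U ∷ʳ z)))
          (trans (length-goodReversals k (b ∷ U ∷ʳ z) (fuel-minFirst a b sp ℓ≤) (minFirst-increasing X↑ sp))
                 (cong (goodCount ∘ suc) (length-∷ʳ U z)))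

count-good : ∀ (p : List ℕ → Bool) n → (∀ {π} → π ∈ S n → T (p π) ⇔ Good (reverse π)) →
             countB p (S n) ≡ goodCount n
count-good p n p⇔good = begin
  countB p (S n)                             ≡⟨ countB-unique p (S-unique n) G! G⇔ ⟩
  length (map reverse (goodReversals n X))   ≡⟨ length-map reverse (goodReversals n X) ⟩
  length (goodReversals n X)                 ≡⟨ length-goodReversals n X X≤n X↑ ⟩
  goodCount (length X)                       ≡⟨ cong goodCount (length-range1 n) ⟩
  goodCount n                                ∎
  where
  open Relation.Binary.PropositionalEquality.≡-Reasoning
  X   = range1 n
  X↑  = range1-increasing n
  X≤n = ≤-reflexive (length-range1 n)
  G! = Unique.map⁺ reverse-injective (goodReversals-unique n X X≤n X↑)
  G⇔ : ∀ {π} → π ∈ map reverse (goodReversals n X) ⇔ (π ∈ S n × T (p π))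
  G⇔ {π} = mk⇔ to from
    where
    to : π ∈ map reverse (goodReversals n X) → π ∈ S n × T (p π)
    to π∈ with ∈-map⁻ reverse π∈
    ... | τ , τ∈ , refl with goodReversals-sound n X X≤n X↑ τ∈
    ...   | τ↭X , good =
      let π∈S = ∈-permsOf⁺ X (↭-trans (↭-reverse τ) τ↭X) in
      π∈S , Equivalence.from (p⇔good π∈S) (subst Good (sym (reverse-involutive τ)) good)
    from : π ∈ S n × T (p π) → π ∈ map reverse (goodReversals n X)
    from (π∈S , pπ) = subst (_∈ map reverse (goodReversals n X)) (reverse-involutive π)
      (∈-map⁺ reverse (goodReversals-complete n X X≤n X↑
        (↭-trans (↭-reverse π) (∈-permsOf⁻ X π∈S)) (Equivalence.to (p⇔good π∈S) pπ)))

Step : List ℕ → ℕ → ℕ → Set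
Step σ x y = at σ x ≡ y

lastOf : ∀ {A : Set} → A → List A → A
lastOf x []      = x
lastOf x (y ∷ r) = lastOf y r

record Orbit (σ : List ℕ) (m f x : ℕ) : Set where
  constructor orbit
  field
    rest    : List ℕ
    unfold  : orbitFrom σ m (suc f) x ≡ x ∷ rest
    path    : Linked (Step σ) (x ∷ rest)
    avoids-m : All (_≢ m) rest
    stops   : Step σ (lastOf x rest) m ⊎ length rest ≡ f

orbitFrom-orbit : ∀ σ m f x → Orbit σ m f x
orbitFrom-orbit σ m f x with at σ x ≡ᵇ m in σx≡ᵇm
... | true = orbit [] (unfold-step σx≡ᵇm) [-] [] (inj₁ (≡ᵇ⇒≡ _ _ (subst T (sym σx≡ᵇm) _)))
  where
  unfold-step : ∀ {b} → (at σ x ≡ᵇ m) ≡ b → orbitFrom σ m (suc f) x ≡ x ∷ (if b then [] else orbitFrom σ m f (at σ x))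
  unfold-step = cong (λ b → x ∷ (if b then [] else orbitFrom σ m f (at σ x)))
orbitFrom-orbit σ m zero    x | false = orbit [] (cong (λ b → x ∷ (if b then [] else [])) σx≡ᵇm) [-] [] (inj₂ refl)
orbitFrom-orbit σ m (suc f) x | false with orbitFrom-orbit σ m f (at σ x)
... | orbit r unfold path avoids stops =
  orbit (at σ x ∷ r)
    (trans (cong (λ b → x ∷ (if b then [] else orbitFrom σ m (suc f) (at σ x))) σx≡ᵇm) (cong (x ∷_) unfold))
    (refl ∷ path) (σx≢m ∷ avoids) (Data.Sum.map₂ (cong suc) stops)
  where
  σx≢m : at σ x ≢ m
  σx≢m σx≡m = subst T σx≡ᵇm (≡⇒≡ᵇ _ _ σx≡m)

module _ {A : Set} {R : A → A → Set} where

  Linked-∷ʳ⁺ : ∀ {x y} r → Linked R (x ∷ r) → R (lastOf x r) y → Linked R (x ∷ r ∷ʳ y)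
  Linked-∷ʳ⁺ []      [-]        Rxy = Rxy ∷ [-]
  Linked-∷ʳ⁺ (z ∷ r) (Rxz ∷ Rr) Rly = Rxz ∷ Linked-∷ʳ⁺ r Rr Rly

  Linked-++-∷-∷ : ∀ u {x y w} → Linked R (u ++ x ∷ y ∷ w) → R x y
  Linked-++-∷-∷ []          (Rxy ∷ _) = Rxy
  Linked-++-∷-∷ (_ ∷ [])    (_ ∷ Rr)  = Linked-++-∷-∷ [] Rr
  Linked-++-∷-∷ (_ ∷ _ ∷ u) (_ ∷ Rr)  = Linked-++-∷-∷ (_ ∷ u) Rr

Cycle : List ℕ → List ℕ → Set
Cycle σ []      = ⊥
Cycle σ (h ∷ t) = Linked (Step σ) (h ∷ t ∷ʳ h)

cycle : ∀ σ {h} t → Linked (Step σ) (h ∷ t) → Step σ (lastOf h t) h → Cycle σ (h ∷ t)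
cycle σ = Linked-∷ʳ⁺

cycle-next : ∀ σ {c} u {x y w} → Cycle σ c → c ≡ u ++ x ∷ y ∷ w → Step σ x y
cycle-next σ {h ∷ t} u {x} {y} {w} cyc eq =
  Linked-++-∷-∷ u (subst (Linked (Step σ)) (trans (cong (_∷ʳ h) eq) (++-assoc u (x ∷ y ∷ w) [ h ])) cyc)

cycle-last : ∀ σ {h t} u {x} → Cycle σ (h ∷ t) → h ∷ t ≡ u ++ x ∷ [] → Step σ x h
cycle-last σ {h} {t} u {x} cyc eq =
  Linked-++-∷-∷ u (subst (Linked (Step σ)) (trans (cong (_∷ʳ h) eq) (++-assoc u (x ∷ []) [ h ])) cyc)

LRMaxBlocks : ℕ → List (List ℕ) → Set
LRMaxBlocks m []             = ⊤
LRMaxBlocks m ([] ∷ bs)      = ⊥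
LRMaxBlocks m ((h ∷ t) ∷ bs) = m < h × All (_< h) t × LRMaxBlocks h bs


++-≡-++-∷ : ∀ {A : Set} (c : List A) {r u x v} → c ++ r ≡ u ++ x ∷ v →
            (∃ λ w → c ≡ u ++ x ∷ w × v ≡ w ++ r) ⊎ (∃ λ u′ → u ≡ c ++ u′ × r ≡ u′ ++ x ∷ v)
++-≡-++-∷ []      {u = u} eq = inj₂ (u , refl , eq)
++-≡-++-∷ (y ∷ c) {u = []}    eq with refl , eq′ ← ∷-injective eq = inj₁ (c , refl , sym eq′)
++-≡-++-∷ (y ∷ c) {u = _ ∷ u} eq with refl , eq′ ← ∷-injective eq with ++-≡-++-∷ c eq′
... | inj₁ (w , refl , refl)  = inj₁ (w , refl , refl)
... | inj₂ (u′ , refl , refl) = inj₂ (u′ , refl , refl)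

unique-adjacent : ∀ {A : Set} (u : List A) {x y w} → Unique (u ++ x ∷ y ∷ w) → x ≢ y
unique-adjacent []      ((x≢y ∷ _) ∷ _) = x≢y
unique-adjacent (_ ∷ u) (_ ∷ u!)         = unique-adjacent u u!

inner<head : ∀ {h h′ t} u {x w} → All (_< h) t → h ∷ t ≡ h′ ∷ u ++ x ∷ w → x < h
inner<head u t<h eq with refl , refl ← ∷-injective eq = All.lookup t<h (∈-++⁺ʳ u (here refl))

not-lrmax : ∀ {h h′ t pre} u {x w} → All (_< h) t → h ∷ t ≡ h′ ∷ u ++ x ∷ w → ¬ All (_< x) (pre ++ h′ ∷ u)
not-lrmax {pre = pre} u t<h eq all<x with refl , _ ← ∷-injective eq =
  <-asym (inner<head u t<h eq) (All.lookup all<x (∈-++⁺ʳ pre (here refl)))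

block-excedance : ∀ {σ h t pre} u {x w} → Cycle σ (h ∷ t) → All (_< h) t → All (_< h) pre → Unique (h ∷ t) →
                  h ∷ t ≡ u ++ x ∷ w → x < at σ x ⇔ (¬ All (_< x) (pre ++ u) × ¬ NextBelow x w)
block-excedance {σ} [] {w = []} cyc t<h pre<h _ refl =
  mk⇔ (λ h<σh → ⊥-elim (<-irrefl (sym (cycle-last σ [] cyc refl)) h<σh))
      (λ (¬pre<h , _) → ⊥-elim (¬pre<h (All.++⁺ pre<h [])))
block-excedance {σ} [] {w = y ∷ w} cyc (y<h ∷ _) pre<h _ refl =
  mk⇔ (λ h<σh → ⊥-elim (<-asym y<h (subst (_ <_) (cycle-next σ [] cyc refl) h<σh)))
      (λ (¬pre<h , _) → ⊥-elim (¬pre<h (All.++⁺ pre<h [])))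
block-excedance {σ} {h} {pre = pre} (h′ ∷ u) {x} {[]} cyc t<h pre<h _ eq =
  mk⇔ (λ _ → not-lrmax u t<h eq , λ ()) (λ _ → subst (x <_) (sym (cycle-last σ (h′ ∷ u) cyc eq)) (inner<head u t<h eq))
block-excedance {σ} {h} {pre = pre} (h′ ∷ u) {x} {y ∷ w} cyc t<h pre<h t! eq =
  mk⇔ (λ x<σx → not-lrmax u t<h eq , λ y<x → <-asym y<x (subst (x <_) σx≡y x<σx))
      (λ (_ , y≮x) → subst (x <_) (sym σx≡y) (≤∧≢⇒< (≮⇒≥ y≮x) (unique-adjacent (h′ ∷ u) (subst Unique eq t!))))
  where
  σx≡y : at σ x ≡ y
  σx≡y = cycle-next σ (h′ ∷ u) cyc eq

AllPairs-++⁻ : ∀ {A : Set} {R : A → A → Set} xs {ys} → AllPairs R (xs ++ ys) → AllPairs R xs × AllPairs R ys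
AllPairs-++⁻ []       R-ys           = [] , R-ys
AllPairs-++⁻ (x ∷ xs) (Rx ∷ R-xsys) =
  let R-xs , R-ys = AllPairs-++⁻ xs R-xsys in All.++⁻ˡ xs Rx ∷ R-xs , R-ys

¬NextBelow-++-blocks : ∀ {x h} w bs → x ≤ h → LRMaxBlocks h bs → ¬ NextBelow x w → ¬ NextBelow x (w ++ concat bs)
¬NextBelow-++-blocks (_ ∷ _) bs             _   _              ¬below = ¬below
¬NextBelow-++-blocks []      []             _   _              _      = λ ()
¬NextBelow-++-blocks []      ((h′ ∷ _) ∷ _) x≤h (h<h′ , _ , _) _      = λ h′<x → <-irrefl refl (<-≤-trans (<-trans h′<x (≤-<-trans x≤h h<h′)) ≤-refl)

blocks-excedance : ∀ {σ} m bs pre {u x v} → LRMaxBlocks m bs → All (Cycle σ) bs → All (_≤ m) pre →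
                   Unique (concat bs) → concat bs ≡ u ++ x ∷ v →
                   x < at σ x ⇔ (¬ All (_< x) (pre ++ u) × ¬ NextBelow x v)
blocks-excedance m [] pre {[]}    _ _ _ _ ()
blocks-excedance m [] pre {_ ∷ _} _ _ _ _ ()
blocks-excedance {σ} m ((h ∷ t) ∷ bs) pre {u} {x} {v} (m<h , t<h , bs-lr) (cyc ∷ cycs) pre≤m bs! eq
  with ++-≡-++-∷ (h ∷ t) eq
... | inj₁ (w , ht≡ , refl) =
  mk⇔ (λ x<σx → let ¬lrmax , ¬below = Equivalence.to in-block x<σx in ¬lrmax , ¬NextBelow-++-blocks w bs x≤h bs-lr ¬below)
      (λ (¬lrmax , ¬below) → Equivalence.from in-block (¬lrmax , λ below → ¬below (NextBelow-++ w below)))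
  where
  in-block = block-excedance {σ} u cyc t<h (All.map (λ p≤m → ≤-<-trans p≤m m<h) pre≤m) (proj₁ (AllPairs-++⁻ (h ∷ t) bs!)) ht≡
  x≤h : x ≤ h
  x≤h with subst (x ∈_) (sym ht≡) (∈-++⁺ʳ u (here refl))
  ... | here refl  = ≤-refl
  ... | there x∈t = <⇒≤ (All.lookup t<h x∈t)
  NextBelow-++ : ∀ w {r} → NextBelow x w → NextBelow x (w ++ r)
  NextBelow-++ (_ ∷ _) below = below
... | inj₂ (u′ , refl , eq′) =
  subst (λ U → x < at σ x ⇔ (¬ All (_< x) U × ¬ NextBelow x v)) (++-assoc pre (h ∷ t) u′)
    (blocks-excedance h bs (pre ++ h ∷ t) bs-lr cycs
      (All.++⁺ (All.map (λ p≤m → <⇒≤ (≤-<-trans p≤m m<h)) pre≤m) (≤-refl ∷ All.map <⇒≤ t<h))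
      (proj₂ (AllPairs-++⁻ (h ∷ t) bs!)) eq′)

at-∈ : ∀ (σ : List ℕ) i → 1 ≤ i → i ≤ length σ → at σ i ∈ σ
at-∈ (x ∷ σ) 1             _ _         = here refl
at-∈ (x ∷ σ) (suc (suc i)) _ (s≤s i≤) = there (at-∈ σ (suc i) (s≤s z≤n) i≤)

at-injective : ∀ {σ : List ℕ} {i j} → Unique σ → 1 ≤ i → i ≤ length σ → 1 ≤ j → j ≤ length σ → at σ i ≡ at σ j → i ≡ j
at-injective {x ∷ σ} {1}           {1}           _          _ _         _ _         _  = refl
at-injective {x ∷ σ} {1}           {suc (suc j)} (x≢σ ∷ _) _ _         _ (s≤s j≤) eq = ⊥-elim (All.lookup x≢σ (at-∈ σ (suc j) (s≤s z≤n) j≤) eq)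
at-injective {x ∷ σ} {suc (suc i)} {1}           (x≢σ ∷ _) _ (s≤s i≤) _ _         eq = ⊥-elim (All.lookup x≢σ (at-∈ σ (suc i) (s≤s z≤n) i≤) (sym eq))
at-injective {x ∷ σ} {suc (suc i)} {suc (suc j)} (_ ∷ σ!)  _ (s≤s i≤) _ (s≤s j≤) eq =
  cong suc (at-injective σ! (s≤s z≤n) i≤ (s≤s z≤n) j≤ eq)

lastOf-∈ : ∀ {A : Set} (x : A) r → lastOf x r ∈ x ∷ r
lastOf-∈ x []      = here refl
lastOf-∈ x (y ∷ r) = there (lastOf-∈ y r)

∈-predecessor : ∀ {A : Set} (x : A) {r y} → y ∈ r → ∃₂ λ u p → ∃ λ w → x ∷ r ≡ u ++ p ∷ y ∷ w
∈-predecessor x {y ∷ r} (here refl) = [] , x , r , refl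
∈-predecessor x {z ∷ r} (there y∈r) with ∈-predecessor z y∈r
... | u , p , w , eq = x ∷ u , p , w , cong (x ∷_) eq

lastOf-++ : ∀ {A : Set} {x : A} {r} u {p y w} → x ∷ r ≡ u ++ p ∷ y ∷ w → lastOf x r ≡ lastOf y w
lastOf-++ []          eq with refl , refl ← ∷-injective eq = refl
lastOf-++ {r = []}    (_ ∷ [])    eq with () ← proj₂ (∷-injective eq)
lastOf-++ {r = []}    (_ ∷ _ ∷ _) eq with () ← proj₂ (∷-injective eq)
lastOf-++ {r = _ ∷ r} (_ ∷ u) eq with refl , eq′ ← ∷-injective eq = lastOf-++ u eq′

length-∈-concat : ∀ {A : Set} (bs : List (List A)) {c} → c ∈ bs → length c ≤ length (concat bs)
length-∈-concat (b ∷ bs)     (here refl) = subst (length b ≤_) (sym (length-++ b)) (m≤m+n _ _)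
length-∈-concat (b ∷ bs) {c} (there c∈)  = subst (length c ≤_) (sym (length-++ b)) (≤-trans (length-∈-concat bs c∈) (m≤n+m _ _))

concat-≡-block : ∀ {A : Set} (bs : List (List A)) {c} → c ∈ bs → All (λ b → b ≢ []) bs →
                 length c ≡ length (concat bs) → concat bs ≡ c
concat-≡-block (c ∷ bs) (here refl) _ len≡ =
  trans (cong (c ++_) (length≡0 (concat bs) (+-cancelˡ-≡ (length c) _ 0 (trans (sym (length-++ c)) (trans (sym len≡) (sym (+-identityʳ _)))))))
        (++-identityʳ c)
  where
  length≡0 : ∀ (xs : List _) → length xs ≡ 0 → xs ≡ []
  length≡0 [] _ = refl
concat-≡-block (b ∷ bs) {c} (there c∈) (b≢[] ∷ _) len≡ = ⊥-elim (<-irrefl len≡ (begin-strict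
  length c                      ≤⟨ length-∈-concat bs c∈ ⟩
  length (concat bs)            <⟨ m<n+m _ (nonempty-length b b≢[]) ⟩
  length b + length (concat bs) ≡⟨ length-++ b ⟨
  length (concat (b ∷ bs))      ∎))
  where
  open Data.Nat.Properties.≤-Reasoning
  nonempty-length : ∀ (xs : List _) → xs ≢ [] → 0 < length xs
  nonempty-length []      xs≢[] = ⊥-elim (xs≢[] refl)
  nonempty-length (_ ∷ _) _     = s≤s z≤n

unique-∉-suffix : ∀ {A : Set} (u : List A) {p ys} → Unique (u ++ p ∷ ys) → p ∉ ys
unique-∉-suffix []      (p≢ys ∷ _) p∈ys = All.lookup p≢ys p∈ys refl
unique-∉-suffix (_ ∷ u) (_ ∷ u!)   = unique-∉-suffix u u!

module CycleForm {n σ π} (σ-perm : IsPermutation n σ) (π-perm : IsPermutation n π) (θσ≡π : θ σ ≡ π) where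

  private
    module σ = IsPermutation σ-perm
    module π = IsPermutation π-perm

  maxima : List ℕ
  maxima = filterB (isCycleMax σ) (range1 (length σ))

  blocks : List (List ℕ)
  blocks = map (cycleOf σ) maxima

  ∈-maxima⁻ : ∀ {h} → h ∈ maxima → h ∈ range1 (length σ) × T (isCycleMax σ h)
  ∈-maxima⁻ h∈ = ∈-filter⁻ (T? ∘ isCycleMax σ) (subst (_ ∈_) (filterB≡filterᵇ (isCycleMax σ) (range1 (length σ))) h∈)

  maxima-increasing : AllPairs _<_ maxima
  maxima-increasing = subst (AllPairs _<_) (sym (filterB≡filterᵇ (isCycleMax σ) (range1 (length σ))))
                        (AllPairs.filter⁺ (T? ∘ isCycleMax σ) (range1-increasing (length σ)))

  cycleOf-orbit : ∀ {h} → h ∈ maxima → ∃ λ f → length σ ≡ suc f × Orbit σ h f h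
  cycleOf-orbit {h} h∈ with length σ | ∈-range1⁻ _ (proj₁ (∈-maxima⁻ h∈))
  ... | suc f | _        = f , refl , orbitFrom-orbit σ h f h
  ... | zero  | 1≤h , h≤0 = ⊥-elim (<-irrefl refl (≤-trans 1≤h h≤0))

  blocks-nonempty : All (λ b → b ≢ []) blocks
  blocks-nonempty = All.map⁺ (All.tabulate nonempty)
    where
    nonempty : ∀ {h} → h ∈ maxima → cycleOf σ h ≢ []
    nonempty h∈ with cycleOf-orbit h∈
    ... | f , ℓ≡ , orbit r unfold _ _ _ = λ eq → case (trans (sym eq) (trans (cong (λ ℓ → orbitFrom σ _ ℓ _) ℓ≡) unfold)) of λ ()

  cycleOf≡ : ∀ {h f} → length σ ≡ suc f → (o : Orbit σ h f h) → cycleOf σ h ≡ h ∷ Orbit.rest o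
  cycleOf≡ {h} ℓ≡ o = trans (cong (λ ℓ → orbitFrom σ h ℓ h) ℓ≡) (Orbit.unfold o)

  -- If π is a single σ-path h ∷ r, then σ of its last entry lies in it, and injectivity of σ
  -- forces that to be its head.
  path-covering-π-closes : ∀ {h r} → π ≡ h ∷ r → Linked (Step σ) (h ∷ r) → Step σ (lastOf h r) h
  path-covering-π-closes {h} {r} π≡ path = closes (subst (at σ ℓ ∈_) π≡ σℓ∈π)
    where
    ℓ = lastOf h r
    h∷r! : Unique (h ∷ r)
    h∷r! = subst Unique π≡ π.unique
    in-range : ∀ {x} → x ∈ h ∷ r → 1 ≤ x × x ≤ length σ
    in-range x∈ = let 1≤x , x≤n = π.∈⇒≤ (subst (_ ∈_) (sym π≡) x∈) in 1≤x , subst (_ ≤_) (sym σ.length≡) x≤n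
    σℓ∈π : at σ ℓ ∈ π
    σℓ∈π = let 1≤ℓ , ℓ≤ = in-range (lastOf-∈ h r) in π.≤⇒∈ (σ.∈⇒≤ (at-∈ σ ℓ 1≤ℓ ℓ≤))
    closes : at σ ℓ ∈ h ∷ r → at σ ℓ ≡ h
    closes (here σℓ≡h)   = σℓ≡h
    closes (there σℓ∈r) with ∈-predecessor h σℓ∈r
    ... | u , p , w , eq = ⊥-elim (unique-∉-suffix u (subst Unique eq h∷r!) (subst (_∈ _) (sym p≡ℓ) ℓ∈))
      where
      p∈ : p ∈ h ∷ r
      p∈ = subst (p ∈_) (sym eq) (∈-++⁺ʳ u (here refl))
      p≡ℓ : p ≡ ℓ
      p≡ℓ = let 1≤p , p≤ = in-range p∈ ; 1≤ℓ , ℓ≤ = in-range (lastOf-∈ h r) in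
            at-injective σ.unique 1≤p p≤ 1≤ℓ ℓ≤ (Linked-++-∷-∷ u (subst (Linked (Step σ)) eq path))
      ℓ∈ : ℓ ∈ at σ ℓ ∷ w
      ℓ∈ = subst (_∈ at σ ℓ ∷ w) (sym (lastOf-++ u eq)) (lastOf-∈ _ w)

  -- An orbit that runs out of fuel has n entries, so it is the only block, i.e. all of π.
  full-orbit-covers-π : ∀ {h f r} → h ∈ maxima → length σ ≡ suc f → cycleOf σ h ≡ h ∷ r → length r ≡ f → π ≡ h ∷ r
  full-orbit-covers-π h∈ ℓ≡ cyc≡ r-full =
    trans (sym θσ≡π) (concat-≡-block blocks (subst (_∈ blocks) cyc≡ (∈-map⁺ (cycleOf σ) h∈)) blocks-nonempty
      (trans (cong suc r-full) (trans (sym ℓ≡) (trans σ.length≡ (trans (sym π.length≡) (cong length (sym θσ≡π)))))))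

  cycleOf-maximum : ∀ {h} → h ∈ maxima → ∃ λ r → cycleOf σ h ≡ h ∷ r × Cycle σ (h ∷ r) × All (_< h) r
  cycleOf-maximum {h} h∈ with cycleOf-orbit h∈
  ... | f , ℓ≡ , o@(orbit r _ path r≢h stops) =
    r , cycleOf≡ ℓ≡ o , cycle σ r path (closes stops) , All.zipWith (λ (y≤h , y≢h) → ≤∧≢⇒< y≤h y≢h) (r≤h , r≢h)
    where
    closes : Step σ (lastOf h r) h ⊎ length r ≡ f → Step σ (lastOf h r) h
    closes (inj₁ step)   = step
    closes (inj₂ r-full) = path-covering-π-closes (full-orbit-covers-π h∈ ℓ≡ (cycleOf≡ ℓ≡ o) r-full) path
    r≤h : All (_≤ h) r
    r≤h with _ ∷ r≤ᵇh ← all⁺ (λ y → y ≤ᵇ h) (h ∷ r) (subst T (trans (allB≡all _ (cycleOf σ h)) (cong (all (λ y → y ≤ᵇ h)) (cycleOf≡ ℓ≡ o))) (proj₂ (∈-maxima⁻ h∈)))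
      = All.map (≤ᵇ⇒≤ _ _) r≤ᵇh

  maxima-blocks : ∀ m hs → (∀ {h} → h ∈ hs → h ∈ maxima) → AllPairs _<_ hs → All (m <_) hs →
                  LRMaxBlocks m (map (cycleOf σ) hs) × All (Cycle σ) (map (cycleOf σ) hs)
  maxima-blocks m []       _   _             _          = tt , []
  maxima-blocks m (h ∷ hs) hs⊆ (h<hs ∷ hs↑) (m<h ∷ _) with cycleOf-maximum (hs⊆ (here refl))
  ... | r , cyc≡ , cyc , r<h rewrite cyc≡ =
    let lr , cycs = maxima-blocks h hs (hs⊆ ∘ there) hs↑ h<hs in (m<h , r<h , lr) , cyc ∷ cycs

  excedance⇔ : ∀ {u x v} → π ≡ u ++ x ∷ v → x < at σ x ⇔ (¬ All (_< x) u × ¬ NextBelow x v)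
  excedance⇔ eq =
    let lr , cycs = maxima-blocks 0 maxima (λ h∈ → h∈) maxima-increasing
                      (All.tabulate (proj₁ ∘ ∈-range1⁻ (length σ) ∘ proj₁ ∘ ∈-maxima⁻)) in
    blocks-excedance 0 blocks [] lr cycs [] (subst Unique (sym θσ≡π) π.unique) (trans θσ≡π eq)

lrMaxBlocks : ∀ m π → Unique π → All (_≢ m) π →
              ∃₂ λ t bs → π ≡ t ++ concat bs × All (_< m) t × LRMaxBlocks m bs
lrMaxBlocks m []       _            _          = [] , [] , refl , [] , tt
lrMaxBlocks m (x ∷ π) (x≢π ∷ π!) (x≢m ∷ π≢m) with <-cmp x m
... | tri< x<m _ _ = let t , bs , eq , t<m , lr = lrMaxBlocks m π π! π≢m in
                     x ∷ t , bs , cong (x ∷_) eq , x<m ∷ t<m , lr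
... | tri≈ _ x≡m _ = ⊥-elim (x≢m x≡m)
... | tri> _ _ m<x = let t , bs , eq , t<x , lr = lrMaxBlocks x π π! (All.map (λ x≢y y≡x → x≢y (sym y≡x)) x≢π) in
                     [] , (x ∷ t) ∷ bs , cong (x ∷_) eq , [] , m<x , t<x , lr

heads : List (List ℕ) → List ℕ
heads []             = []
heads ([] ∷ bs)      = heads bs
heads ((h ∷ _) ∷ bs) = h ∷ heads bs

heads-increasing : ∀ {m} bs → LRMaxBlocks m bs → AllPairs _<_ (heads bs) × All (m <_) (heads bs)
heads-increasing []             _                = [] , []
heads-increasing ((h ∷ t) ∷ bs) (m<h , _ , lr) =
  let hs↑ , h<hs = heads-increasing bs lr in h<hs ∷ hs↑ , m<h ∷ All.map (<-trans m<h) h<hs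

∈-heads⁻ : ∀ {m} bs {h} → LRMaxBlocks m bs → h ∈ heads bs → ∃ λ t → (h ∷ t) ∈ bs
∈-heads⁻ ((h ∷ t) ∷ bs) _            (here refl) = t , here refl
∈-heads⁻ ((_ ∷ _) ∷ bs) (_ , _ , lr) (there h∈)  = let t , ht∈ = ∈-heads⁻ bs lr h∈ in t , there ht∈

∈-heads⁺ : ∀ bs {h t} → (h ∷ t) ∈ bs → h ∈ heads bs
∈-heads⁺ ([] ∷ bs)      (there ht∈) = ∈-heads⁺ bs ht∈
∈-heads⁺ ((h ∷ t) ∷ bs) (here refl) = here refl
∈-heads⁺ ((_ ∷ _) ∷ bs) (there ht∈) = there (∈-heads⁺ bs ht∈)

∈-blocks⁻ : ∀ (bs : List (List ℕ)) {x} → x ∈ concat bs → ∃₂ λ h t → (h ∷ t) ∈ bs × (x ≡ h ⊎ x ∈ t)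
∈-blocks⁻ ([] ∷ bs)      x∈ = let h , t , ht∈ , x∈ht = ∈-blocks⁻ bs x∈ in h , t , there ht∈ , x∈ht
∈-blocks⁻ ((h ∷ t) ∷ bs) (here refl) = h , t , here refl , inj₁ refl
∈-blocks⁻ ((h ∷ t) ∷ bs) (there x∈) with ∈-++⁻ t x∈
... | inj₁ x∈t = h , t , here refl , inj₂ x∈t
... | inj₂ x∈bs = let h′ , t′ , ht∈ , x∈ht = ∈-blocks⁻ bs x∈bs in h′ , t′ , there ht∈ , x∈ht

pathEdges : ℕ → ℕ → List ℕ → List (ℕ × ℕ)
pathEdges h x []      = (x , h) ∷ []
pathEdges h x (y ∷ r) = (x , y) ∷ pathEdges h y r

cycleEdges : List ℕ → List (ℕ × ℕ)
cycleEdges []      = []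
cycleEdges (h ∷ t) = pathEdges h h t

keys-pathEdges : ∀ h x r → map proj₁ (pathEdges h x r) ≡ x ∷ r
keys-pathEdges h x []      = refl
keys-pathEdges h x (y ∷ r) = cong (x ∷_) (keys-pathEdges h y r)

values-pathEdges : ∀ h x r → map proj₂ (pathEdges h x r) ≡ r ∷ʳ h
values-pathEdges h x []      = refl
values-pathEdges h x (y ∷ r) = cong (y ∷_) (values-pathEdges h y r)

keys-cycleEdges : ∀ bs → map proj₁ (concatMap cycleEdges bs) ≡ concat bs
keys-cycleEdges []             = refl
keys-cycleEdges ([] ∷ bs)      = keys-cycleEdges bs
keys-cycleEdges ((h ∷ t) ∷ bs) =
  trans (map-++ proj₁ (pathEdges h h t) _) (cong₂ _++_ (keys-pathEdges h h t) (keys-cycleEdges bs))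

values-cycleEdges : ∀ bs → map proj₂ (concatMap cycleEdges bs) ↭ concat bs
values-cycleEdges []             = ↭-refl
values-cycleEdges ([] ∷ bs)      = values-cycleEdges bs
values-cycleEdges ((h ∷ t) ∷ bs) = begin
  map proj₂ (pathEdges h h t ++ concatMap cycleEdges bs)             ≡⟨ map-++ proj₂ (pathEdges h h t) _ ⟩
  map proj₂ (pathEdges h h t) ++ map proj₂ (concatMap cycleEdges bs) ≡⟨ cong (_++ _) (values-pathEdges h h t) ⟩
  (t ∷ʳ h) ++ map proj₂ (concatMap cycleEdges bs)                    ↭⟨ ++⁺ʳ _ (++-comm t [ h ]) ⟩
  (h ∷ t) ++ map proj₂ (concatMap cycleEdges bs)                     ↭⟨ ++⁺ˡ (h ∷ t) (values-cycleEdges bs) ⟩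
  (h ∷ t) ++ concat bs                                                ∎
  where open PermutationReasoning

pathEdges-Linked : ∀ σ h x r → All (λ (k , v) → Step σ k v) (pathEdges h x r) → Linked (Step σ) (x ∷ r ∷ʳ h)
pathEdges-Linked σ h x []      (step ∷ [])    = step ∷ [-]
pathEdges-Linked σ h x (y ∷ r) (step ∷ steps) = step ∷ pathEdges-Linked σ h y r steps

lookupKey : List (ℕ × ℕ) → ℕ → ℕ
lookupKey []             x = 0
lookupKey ((k , v) ∷ E) x = if k ≡ᵇ x then v else lookupKey E x

lookupKey-∈ : ∀ {E k v} → Unique (map proj₁ E) → (k , v) ∈ E → lookupKey E k ≡ v
lookupKey-∈ {(k , v) ∷ E} _ (here refl) rewrite Equivalence.to T-≡ (≡⇒≡ᵇ k k refl) = refl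
lookupKey-∈ {(k′ , v′) ∷ E} {k} (k′∉ ∷ E!) (there kv∈) with k′ ≡ᵇ k in k′≡ᵇk
... | true  = ⊥-elim (All.lookup k′∉ (∈-map⁺ proj₁ kv∈) (≡ᵇ⇒≡ k′ k (subst T (sym k′≡ᵇk) tt)))
... | false = lookupKey-∈ E! kv∈

≡ᵇ-false : ∀ {m n} → m ≢ n → (m ≡ᵇ n) ≡ false
≡ᵇ-false {m} {n} m≢n with m ≡ᵇ n in m≡ᵇn
... | true  = ⊥-elim (m≢n (≡ᵇ⇒≡ m n (subst T (sym m≡ᵇn) tt)))
... | false = refl

orbitFrom-path : ∀ {σ m f x} r → Linked (Step σ) (x ∷ r) → All (_≢ m) r → Step σ (lastOf x r) m → length r ≤ f →
                 orbitFrom σ m (suc f) x ≡ x ∷ r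
orbitFrom-path {σ} {m} {f} {x} [] _ _ σx≡m _ =
  cong (λ b → x ∷ (if b then [] else orbitFrom σ m f (at σ x))) (Equivalence.to T-≡ (≡⇒≡ᵇ _ _ σx≡m))
orbitFrom-path {σ} {m} {suc f} {x} (y ∷ r) (σx≡y ∷ path) (y≢m ∷ r≢m) closes (s≤s r≤f) =
  trans (cong (λ b → x ∷ (if b then [] else orbitFrom σ m (suc f) (at σ x))) (≡ᵇ-false (λ σx≡m → y≢m (trans (sym σx≡y) σx≡m))))
        (cong (λ z → x ∷ orbitFrom σ m (suc f) z) σx≡y ⟨trans⟩ cong (x ∷_) (orbitFrom-path r path r≢m closes r≤f))
  where open Relation.Binary.PropositionalEquality using () renaming (trans to _⟨trans⟩_)

orbitFrom-⊇ : ∀ {σ m f x} r → Linked (Step σ) (x ∷ r) → All (_≢ m) r → length r ≤ f →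
              ∀ {y} → y ∈ x ∷ r → y ∈ orbitFrom σ m (suc f) x
orbitFrom-⊇ _ _ _ _ (here refl) = here refl
orbitFrom-⊇ {σ} {m} {suc f} {x} (z ∷ r) (σx≡z ∷ path) (z≢m ∷ r≢m) (s≤s r≤f) {y} (there y∈) =
  subst (y ∈_) (sym (cong (λ b → x ∷ (if b then [] else orbitFrom σ m (suc f) (at σ x))) (≡ᵇ-false (λ σx≡m → z≢m (trans (sym σx≡z) σx≡m)))))
    (there (subst (λ w → y ∈ orbitFrom σ m (suc f) w) (sym σx≡z) (orbitFrom-⊇ r path r≢m r≤f y∈)))

pathEdges-path : ∀ σ h x r → All (λ (k , v) → Step σ k v) (pathEdges h x r) → Linked (Step σ) (x ∷ r) × Step σ (lastOf x r) h
pathEdges-path σ h x []      (step ∷ [])    = [-] , step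
pathEdges-path σ h x (y ∷ r) (step ∷ steps) = let path , closes = pathEdges-path σ h y r steps in step ∷ path , closes

Linked-++⁻ʳ : ∀ {A : Set} {R : A → A → Set} u {ys} → Linked R (u ++ ys) → Linked R ys
Linked-++⁻ʳ []      R-ys   = R-ys
Linked-++⁻ʳ (_ ∷ u) R-uys = Linked-++⁻ʳ u (Linked.tail R-uys)

increasing-set⇒≡ : ∀ {xs ys} → AllPairs _<_ xs → AllPairs _<_ ys → (∀ {z} → z ∈ xs → z ∈ ys) → (∀ {z} → z ∈ ys → z ∈ xs) → xs ≡ ys
increasing-set⇒≡ {[]}     {[]}    _ _ _ _ = refl
increasing-set⇒≡ {[]}     {_ ∷ _} _ _ _ ys⊆ with () ← ys⊆ (here refl)
increasing-set⇒≡ {_ ∷ _}  {[]}    _ _ xs⊆ _ with () ← xs⊆ (here refl)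
increasing-set⇒≡ {x ∷ xs} {y ∷ ys} (x<xs ∷ xs↑) (y<ys ∷ ys↑) xs⊆ ys⊆ with xs⊆ (here refl) | ys⊆ (here refl)
... | there x∈ys | there y∈xs = ⊥-elim (<-asym (All.lookup x<xs y∈xs) (All.lookup y<ys x∈ys))
... | there x∈ys | here refl  = ⊥-elim (<-irrefl refl (All.lookup y<ys x∈ys))
... | here refl  | _          = cong (x ∷_) (increasing-set⇒≡ xs↑ ys↑ (strip x<xs xs⊆) (strip y<ys ys⊆))
  where
  strip : ∀ {zs ws} → All (x <_) zs → (∀ {z} → z ∈ x ∷ zs → z ∈ x ∷ ws) → ∀ {z} → z ∈ zs → z ∈ ws
  strip x<zs zs⊆ z∈ with zs⊆ (there z∈)
  ... | here refl = ⊥-elim (<-irrefl refl (All.lookup x<zs z∈))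
  ... | there z∈ws = z∈ws

at-map : ∀ (f : ℕ → ℕ) xs i → 1 ≤ i → i ≤ length xs → at (map f xs) i ≡ f (at xs i)
at-map f (x ∷ xs) 1             _ _        = refl
at-map f (x ∷ xs) (suc (suc i)) _ (s≤s i≤) = at-map f xs (suc i) (s≤s z≤n) i≤

at-applyUpTo : ∀ (g : ℕ → ℕ) n i → i < n → at (applyUpTo g n) (suc i) ≡ g i
at-applyUpTo g (suc n) zero    _         = refl
at-applyUpTo g (suc n) (suc i) (s≤s i<n) = at-applyUpTo (g ∘ suc) n i i<n

at-range1 : ∀ n {x} → 1 ≤ x → x ≤ n → at (range1 n) x ≡ x
at-range1 n {suc i} _ i<n = trans (cong (λ xs → at xs (suc i)) (map-applyUpTo (λ i → i) suc n)) (at-applyUpTo suc n i i<n)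

allB-∈ : ∀ {A : Set} (p : A → Bool) {xs y} → T (allB p xs) → y ∈ xs → T (p y)
allB-∈ p {xs} all-p y∈ = All.lookup (all⁺ p xs (subst T (allB≡all p xs) all-p)) y∈

lrmax-block : ∀ {m bs h t} → LRMaxBlocks m bs → (h ∷ t) ∈ bs → All (_< h) t
lrmax-block {bs = (_ ∷ _) ∷ _} (_ , t<h , _) (here refl) = t<h
lrmax-block {bs = (_ ∷ _) ∷ _} (_ , _ , lr)  (there ht∈) = lrmax-block lr ht∈

unique-∈-concat : ∀ {A : Set} (bs : List (List A)) {b} → b ∈ bs → Unique (concat bs) → Unique b
unique-∈-concat (b ∷ bs) (here refl) bs! = proj₁ (AllPairs-++⁻ b bs!)
unique-∈-concat (b ∷ bs) (there b∈)  bs! = unique-∈-concat bs b∈ (proj₂ (AllPairs-++⁻ b bs!))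


≤-suc-split : ∀ {k m} → suc k ≤ m → ∃ λ f → m ≡ suc f × k ≤ f
≤-suc-split (s≤s k≤f) = _ , refl , k≤f

module CanonicalPreimage {n π} (π↭ : π ↭ range1 n) where

  private
    module π = IsPermutation (↭range1⇒IsPermutation π↭)

    decomposition = lrMaxBlocks 0 π π.unique (All.tabulate (λ x∈π x≡0 → <-irrefl (sym x≡0) (proj₁ (π.∈⇒≤ x∈π))))

  blocks : List (List ℕ)
  blocks = proj₁ (proj₂ decomposition)

  blocks-lrmax : LRMaxBlocks 0 blocks
  blocks-lrmax = proj₂ (proj₂ (proj₂ (proj₂ decomposition)))

  π≡concat : π ≡ concat blocks
  π≡concat with proj₁ decomposition | proj₁ (proj₂ (proj₂ decomposition)) | proj₁ (proj₂ (proj₂ (proj₂ decomposition)))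
  ... | []    | eq | _        = eq
  ... | _ ∷ _ | _  | () ∷ _

  edges : List (ℕ × ℕ)
  edges = concatMap cycleEdges blocks

  next : ℕ → ℕ
  next = lookupKey edges

  σ₀ : List ℕ
  σ₀ = map next (range1 n)

  next-edge : ∀ {k v} → (k , v) ∈ edges → next k ≡ v
  next-edge = lookupKey-∈ (subst Unique (trans π≡concat (sym (keys-cycleEdges blocks))) π.unique)

  σ₀↭ : σ₀ ↭ range1 n
  σ₀↭ = begin
    map next (range1 n)                  ↭⟨ map⁺ next (↭-sym π↭) ⟩
    map next π                           ≡⟨ cong (map next) (trans π≡concat (sym (keys-cycleEdges blocks))) ⟩
    map next (map proj₁ edges)           ≡⟨ sym (map-∘ edges) ⟩
    map (next ∘ proj₁) edges             ≡⟨ map-cong-local (All.tabulate next-edge) ⟩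
    map proj₂ edges                      ↭⟨ values-cycleEdges blocks ⟩
    concat blocks                        ≡⟨ sym π≡concat ⟩
    π                                    ↭⟨ π↭ ⟩
    range1 n                             ∎
    where open PermutationReasoning

  length-σ₀ : length σ₀ ≡ n
  length-σ₀ = trans (length-map next (range1 n)) (length-range1 n)

  at-σ₀ : ∀ {x} → x ∈ π → at σ₀ x ≡ next x
  at-σ₀ {x} x∈π = let 1≤x , x≤n = π.∈⇒≤ x∈π in
    trans (at-map next (range1 n) x 1≤x (subst (x ≤_) (sym (length-range1 n)) x≤n)) (cong next (at-range1 n 1≤x x≤n))

  private
    keys⊆π : ∀ {k v} → (k , v) ∈ edges → k ∈ π
    keys⊆π kv∈ = subst (_ ∈_) (trans (keys-cycleEdges blocks) (sym π≡concat)) (∈-map⁺ proj₁ kv∈)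

    block∈ : ∀ {h t} → (h ∷ t) ∈ blocks → ∀ {x} → x ∈ h ∷ t → x ∈ π
    block∈ ht∈ x∈ = subst (_ ∈_) (sym π≡concat) (∈-concat⁺′ x∈ ht∈)

    fuel : ∀ {h t} → (h ∷ t) ∈ blocks → ∃ λ f → length σ₀ ≡ suc f × length t ≤ f
    fuel {h} {t} ht∈ = ≤-suc-split (subst (suc (length t) ≤_) (trans (cong length (sym π≡concat)) (trans π.length≡ (sym length-σ₀)))
                                           (length-∈-concat blocks ht∈))

  block-path : ∀ {h t} → (h ∷ t) ∈ blocks → Linked (Step σ₀) (h ∷ t) × Step σ₀ (lastOf h t) h
  block-path {h} {t} ht∈ = pathEdges-path σ₀ h h t (All.tabulate step)
    where
    step : ∀ {e} → e ∈ pathEdges h h t → Step σ₀ (proj₁ e) (proj₂ e)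
    step {k , v} kv∈ = let kv∈edges = ∈-concatMap⁺ cycleEdges {xs = blocks} (lose ht∈ kv∈) in
      trans (at-σ₀ (keys⊆π kv∈edges)) (next-edge kv∈edges)

  block-cycle : ∀ {h t} → (h ∷ t) ∈ blocks → Cycle σ₀ (h ∷ t)
  block-cycle {h} {t} ht∈ = let path , closes = block-path ht∈ in cycle σ₀ t path closes

  block-below-head : ∀ {h t} → (h ∷ t) ∈ blocks → All (_< h) t
  block-below-head = lrmax-block blocks-lrmax

  cycleOf-head : ∀ {h t} → (h ∷ t) ∈ blocks → cycleOf σ₀ h ≡ h ∷ t
  cycleOf-head {h} {t} ht∈ with fuel ht∈ | block-path ht∈
  ... | f , ℓ≡ , t≤f | path , closes =
    trans (cong (λ ℓ → orbitFrom σ₀ h ℓ h) ℓ≡)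
          (orbitFrom-path t path (All.map (λ y<h y≡h → <-irrefl y≡h y<h) (block-below-head ht∈)) closes t≤f)

  isCycleMax-head : ∀ {h t} → (h ∷ t) ∈ blocks → T (isCycleMax σ₀ h)
  isCycleMax-head {h} {t} ht∈ =
    subst T (sym (trans (cong (allB (λ y → y ≤ᵇ h)) (cycleOf-head ht∈)) (allB≡all (λ y → y ≤ᵇ h) (h ∷ t))))
      (all⁻ (λ y → y ≤ᵇ h) {h ∷ t} (≤⇒≤ᵇ (≤-refl {h}) ∷ All.map (≤⇒≤ᵇ ∘ <⇒≤) (block-below-head ht∈)))

  -- The orbit of a non-head x of a block runs through the rest of the block up to its head h > x.
  ¬isCycleMax-tail : ∀ {h t x} → (h ∷ t) ∈ blocks → x ∈ t → ¬ T (isCycleMax σ₀ x)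
  ¬isCycleMax-tail {h} {t} {x} ht∈ x∈t max with ∈-∃++ x∈t | fuel ht∈
  ... | t₁ , t₂ , refl | f , ℓ≡ , t≤f =
    <-irrefl refl (<-≤-trans x<h (≤ᵇ⇒≤ h x (allB-∈ (λ y → y ≤ᵇ x) max h∈orbit)))
    where
    x<h : x < h
    x<h = All.lookup (block-below-head ht∈) x∈t
    path : Linked (Step σ₀) (x ∷ t₂ ∷ʳ h)
    path = Linked-++⁻ʳ (h ∷ t₁) (subst (Linked (Step σ₀)) (cong (h ∷_) (++-assoc t₁ (x ∷ t₂) [ h ])) (block-cycle ht∈))
    avoids-x : All (_≢ x) (t₂ ∷ʳ h)
    avoids-x = All.++⁺ (All.tabulate (λ y∈ y≡x → unique-∉-suffix (h ∷ t₁) (unique-∈-concat blocks ht∈ (subst Unique π≡concat π.unique)) (subst (_∈ t₂) y≡x y∈)))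
                       ((λ h≡x → <-irrefl (sym h≡x) x<h) ∷ [])
    length≤ : length (t₂ ∷ʳ h) ≤ f
    length≤ = ≤-trans (≤-reflexive (length-∷ʳ t₂ h)) (≤-trans (m≤n+m (suc (length t₂)) (length t₁)) (≤-trans (≤-reflexive (sym (length-++ t₁))) t≤f))
    h∈orbit : h ∈ cycleOf σ₀ x
    h∈orbit = subst (λ ℓ → h ∈ orbitFrom σ₀ x ℓ x) (sym ℓ≡) (orbitFrom-⊇ (t₂ ∷ʳ h) path avoids-x length≤ (there (∈-++⁺ʳ t₂ (here refl))))

  maxima≡heads : filterB (isCycleMax σ₀) (range1 n) ≡ heads blocks
  maxima≡heads = increasing-set⇒≡ (filterB-AllPairs (isCycleMax σ₀) (range1-increasing n)) (proj₁ (heads-increasing blocks blocks-lrmax)) ⊆heads heads⊆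
    where
    ⊆heads : ∀ {y} → y ∈ filterB (isCycleMax σ₀) (range1 n) → y ∈ heads blocks
    ⊆heads y∈ with ∈-filterB⁻ (isCycleMax σ₀) (range1 n) y∈
    ... | y∈range , max with ∈-blocks⁻ blocks (subst (_ ∈_) π≡concat (π.≤⇒∈ (∈-range1⁻ n y∈range)))
    ...   | h , t , ht∈ , inj₁ refl = ∈-heads⁺ blocks ht∈
    ...   | h , t , ht∈ , inj₂ y∈t  = ⊥-elim (¬isCycleMax-tail ht∈ y∈t max)
    heads⊆ : ∀ {y} → y ∈ heads blocks → y ∈ filterB (isCycleMax σ₀) (range1 n)
    heads⊆ y∈ with ∈-heads⁻ blocks blocks-lrmax y∈
    ... | t , yt∈ = ∈-filterB⁺ (isCycleMax σ₀) (range1 n)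
                      (let 1≤y , y≤n = π.∈⇒≤ (block∈ yt∈ (here refl)) in ∈-range1⁺ n 1≤y y≤n) (isCycleMax-head yt∈)

  map-cycleOf-heads : ∀ {m} bs → LRMaxBlocks m bs → (∀ {b} → b ∈ bs → b ∈ blocks) → map (cycleOf σ₀) (heads bs) ≡ bs
  map-cycleOf-heads []             _              _    = refl
  map-cycleOf-heads ((h ∷ t) ∷ bs) (_ , _ , lr)   bs⊆ =
    cong₂ _∷_ (cycleOf-head (bs⊆ (here refl))) (map-cycleOf-heads bs lr (bs⊆ ∘ there))

  θσ₀≡π : θ σ₀ ≡ π
  θσ₀≡π = begin
    concat (map (cycleOf σ₀) (filterB (isCycleMax σ₀) (range1 (length σ₀)))) ≡⟨ cong (λ ℓ → concat (map (cycleOf σ₀) (filterB (isCycleMax σ₀) (range1 ℓ)))) length-σ₀ ⟩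
    concat (map (cycleOf σ₀) (filterB (isCycleMax σ₀) (range1 n)))           ≡⟨ cong (concat ∘ map (cycleOf σ₀)) maxima≡heads ⟩
    concat (map (cycleOf σ₀) (heads blocks))                                  ≡⟨ cong concat (map-cycleOf-heads blocks blocks-lrmax (λ b∈ → b∈)) ⟩
    concat blocks                                                             ≡⟨ π≡concat ⟨
    π                                                                         ∎
    where open Relation.Binary.PropositionalEquality.≡-Reasoning

hat-spec : ∀ {n π} → π ∈ S n → hat π ∈ S n × θ (hat π) ≡ π
hat-spec {n} {π} π∈S =
  let σ∈ , θσ≈π = firstSuch-satisfies (λ σ → eqList (θ σ) π) [] (S n) σ₀∈S (subst (λ ρ → T (eqList ρ π)) (sym θσ₀≡π) (eqList-refl π)) in
  subst (_∈ S n) (sym hat≡) σ∈ , eqList-sound _ π (subst (λ σ → T (eqList (θ σ) π)) (sym hat≡) θσ≈π)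
  where
  π↭ = ∈-permsOf⁻ (range1 n) π∈S
  open CanonicalPreimage π↭ using (σ₀; σ₀↭; θσ₀≡π)
  σ₀∈S : σ₀ ∈ S n
  σ₀∈S = ∈-permsOf⁺ (range1 n) σ₀↭
  hat≡ : hat π ≡ firstSuch (λ σ → eqList (θ σ) π) [] (S n)
  hat≡ = cong (λ ℓ → firstSuch (λ σ → eqList (θ σ) π) [] (S ℓ)) (IsPermutation.length≡ (∈-S⇒IsPermutation n π∈S))

hat-excedance⇔ : ∀ n {π u x v} → π ∈ S n → π ≡ u ++ x ∷ v → x < at (hat π) x ⇔ (¬ All (_< x) u × ¬ NextBelow x v)
hat-excedance⇔ n π∈S = let σ∈S , θσ≡π = hat-spec {n} π∈S in
  CycleForm.excedance⇔ (∈-S⇒IsPermutation n σ∈S) (∈-S⇒IsPermutation n π∈S) θσ≡π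


[]∈subseqs : ∀ (w : List ℕ) → [] ∈ subseqs w
[]∈subseqs []      = here refl
[]∈subseqs (x ∷ w) = ∈-++⁺ʳ (map (x ∷_) (subseqs w)) ([]∈subseqs w)

∈-subseqs-++ : ∀ (u : List ℕ) {s} w → s ∈ subseqs w → s ∈ subseqs (u ++ w)
∈-subseqs-++ []      w s∈ = s∈
∈-subseqs-++ (x ∷ u) w s∈ = ∈-++⁺ʳ (map (x ∷_) (subseqs (u ++ w))) (∈-subseqs-++ u w s∈)

∈-subseqs-∷ : ∀ x {s} w → s ∈ subseqs w → x ∷ s ∈ subseqs (x ∷ w)
∈-subseqs-∷ x w s∈ = ∈-++⁺ˡ (∈-map⁺ (x ∷_) s∈)

∈-subseqs-∷⁻ : ∀ w {x s} → x ∷ s ∈ subseqs w → ∃₂ λ u w′ → w ≡ u ++ x ∷ w′ × s ∈ subseqs w′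
∈-subseqs-∷⁻ []      (here ())
∈-subseqs-∷⁻ []      (there ())
∈-subseqs-∷⁻ (y ∷ w) xs∈ with ∈-++⁻ (map (y ∷_) (subseqs w)) xs∈
... | inj₁ xs∈ˡ with ∈-map⁻ (y ∷_) xs∈ˡ
...   | _ , s∈ , eq with refl , refl ← ∷-injective eq = [] , w , refl , s∈
∈-subseqs-∷⁻ (y ∷ w) xs∈ | inj₂ xs∈ʳ with ∈-subseqs-∷⁻ w xs∈ʳ
... | u , w′ , refl , s∈ = y ∷ u , w′ , refl , s∈

subseqs≡map-proj₁-interleavings : ∀ (w : List ℕ) → subseqs w ≡ map proj₁ (interleavings w)
subseqs≡map-proj₁-interleavings []      = refl
subseqs≡map-proj₁-interleavings (x ∷ w) = begin
  map (x ∷_) (subseqs w) ++ subseqs w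
    ≡⟨ cong₂ (λ l r → map (x ∷_) l ++ r) (subseqs≡map-proj₁-interleavings w) (subseqs≡map-proj₁-interleavings w) ⟩
  map (x ∷_) (map proj₁ I) ++ map proj₁ I
    ≡⟨ cong₂ _++_ (trans (sym (map-∘ {g = x ∷_} {f = proj₁} I)) (map-∘ {g = proj₁} {f = λ (l , r) → x ∷ l , r} I))
                  (map-∘ {g = proj₁} {f = λ (l , r) → l , x ∷ r} I) ⟩
  map proj₁ (map (λ (l , r) → x ∷ l , r) I) ++ map proj₁ (map (λ (l , r) → l , x ∷ r) I)
    ≡⟨ map-++ proj₁ (map (λ (l , r) → x ∷ l , r) I) _ ⟨
  map proj₁ (map (λ (l , r) → x ∷ l , r) I ++ map (λ (l , r) → l , x ∷ r) I) ∎
  where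
  open Relation.Binary.PropositionalEquality.≡-Reasoning
  I = interleavings w

∈-subseqs⁻ : ∀ w {s} → s ∈ subseqs w → ∃ λ r → Interleaving s r w
∈-subseqs⁻ w s∈ with ∈-map⁻ proj₁ (subst (_ ∈_) (subseqs≡map-proj₁-interleavings w) s∈)
... | (_ , r) , sr∈ , refl = r , ∈-interleavings⁻ w sr∈

∈-subseqs⁺ : ∀ {w s r} → Interleaving s r w → s ∈ subseqs w
∈-subseqs⁺ {w} sp = subst (_ ∈_) (sym (subseqs≡map-proj₁-interleavings w)) (∈-map⁺ proj₁ (∈-interleavings⁺ sp))

Occurrence : List ℕ → Set
Occurrence π = ∃₂ λ u x → ∃ λ v → π ≡ u ++ x ∷ v × (∃ λ y → y ∈ u × y < x) × x < at (hat π) x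

pattern₃ : List ℕ → Bool
pattern₃ = contains 3 (1 ∷ 2 ∷ []) ((2 , 3) ∷ [])

contains⇒occurrence : ∀ π → T (pattern₃ π) → Occurrence π
contains⇒occurrence π c with anyB⁻ _ (kSubsets (length π) 3) c
... | X , X∈ , PX with ∈-filterB⁻ (λ X → length X ≡ᵇ 3) (subseqs (range1 (length π))) X∈
... | X∈subseqs , len≡ᵇ3 with X | ≡ᵇ⇒≡ (length X) 3 len≡ᵇ3
...   | x₁ ∷ x₂ ∷ x₃ ∷ [] | refl with Equivalence.to T-∧ PX | interleaving-AllPairsˡ (range1-increasing (length π)) (proj₂ (∈-subseqs⁻ _ X∈subseqs))
...     | sub , rel | (x₁<x₂ ∷ _) ∷ (x₂<x₃ ∷ []) ∷ _ with anyB⁻ _ (subseqs π) sub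
...       | s , s∈ , s≡ with eqList-sound s (x₁ ∷ x₂ ∷ []) s≡
...         | refl with ∈-subseqs-∷⁻ π s∈
...           | A , w , π≡ , x₂∈ with ∈-subseqs-∷⁻ w x₂∈
...             | B , U , w≡ , _ =
  A ++ x₁ ∷ B , x₂ , U , trans π≡ (trans (cong (λ w → A ++ x₁ ∷ w) w≡) (sym (++-assoc A (x₁ ∷ B) (x₂ ∷ U)))) ,
  (x₁ , ∈-++⁺ʳ A (here refl) , x₁<x₂) ,
  subst (x₂ <_) (sym (≡ᵇ⇒≡ (at (hat π) x₂) x₃ (proj₁ (Equivalence.to T-∧ rel)))) x₂<x₃

occurrence⇒contains : ∀ n {π} → π ∈ S n → Occurrence π → T (pattern₃ π)
occurrence⇒contains n {π} π∈S (u , x , v , π≡ , (y , y∈u , y<x) , x<σx) =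
  anyB⁺ _ (kSubsets (length π) 3) X∈
    (Equivalence.from T-∧ (anyB⁺ _ (subseqs π) yx∈ (eqList-refl (y ∷ x ∷ [])) , Equivalence.from T-∧ (≡⇒≡ᵇ σx σx refl , tt)))
  where
  module π = IsPermutation (∈-S⇒IsPermutation n π∈S)
  module σ = IsPermutation (∈-S⇒IsPermutation n (proj₁ (hat-spec {n} π∈S)))
  σx = at (hat π) x
  X = y ∷ x ∷ σx ∷ []
  x∈π : x ∈ π
  x∈π = subst (x ∈_) (sym π≡) (∈-++⁺ʳ u (here refl))
  in-range : ∀ {z} → z ∈ X → z ∈ range1 (length π)
  in-range {z} z∈ = subst (λ m → z ∈ range1 m) (sym π.length≡) (uncurry (∈-range1⁺ n) (bounds z∈))
    where
    bounds : z ∈ X → 1 ≤ z × z ≤ n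
    bounds (here refl)                 = π.∈⇒≤ (subst (y ∈_) (sym π≡) (∈-++⁺ˡ y∈u))
    bounds (there (here refl))         = π.∈⇒≤ x∈π
    bounds (there (there (here refl))) =
      let 1≤x , x≤n = π.∈⇒≤ x∈π in σ.∈⇒≤ (at-∈ (hat π) x 1≤x (subst (x ≤_) (sym σ.length≡) x≤n))
  X∈ : X ∈ kSubsets (length π) 3
  X∈ = ∈-filterB⁺ (λ X → length X ≡ᵇ 3) (subseqs (range1 (length π)))
         (∈-subseqs⁺ (proj₂ (interleaving-exists (range1-increasing (length π)) ((y<x ∷ <-trans y<x x<σx ∷ []) ∷ (x<σx ∷ []) ∷ [] ∷ []) in-range))) tt
  yx∈ : y ∷ x ∷ [] ∈ subseqs π
  yx∈ with ∈-∃++ y∈u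
  ... | A , B , refl = subst (λ w → y ∷ x ∷ [] ∈ subseqs w) (sym (trans π≡ (++-assoc A (y ∷ B) (x ∷ v))))
                         (∈-subseqs-++ A (y ∷ B ++ x ∷ v) (∈-subseqs-∷ y (B ++ x ∷ v) (∈-subseqs-++ B (x ∷ v) (∈-subseqs-∷ x v ([]∈subseqs v)))))

nextBelow? : ∀ x v → Dec (NextBelow x v)
nextBelow? x []      = no λ ()
nextBelow? x (y ∷ _) = y <? x

unique-∉-prefix : ∀ {A : Set} (u : List A) {x v} → Unique (u ++ x ∷ v) → x ∉ u
unique-∉-prefix (y ∷ u) (y≢ ∷ _) (here refl) = All.lookup y≢ (∈-++⁺ʳ u (here refl)) refl
unique-∉-prefix (y ∷ u) (_ ∷ u!) (there x∈u) = unique-∉-prefix u u! x∈u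

¬occurrence⇔EntrywiseGood : ∀ n {π} → π ∈ S n → (¬ Occurrence π) ⇔ EntrywiseGood π
¬occurrence⇔EntrywiseGood n {π} π∈S = mk⇔ to from
  where
  to : ¬ Occurrence π → EntrywiseGood π
  to ¬occ u x v π≡ with extreme? x u ⊎-dec nextBelow? x v
  ... | yes ok = ok
  ... | no ¬ok = ⊥-elim (¬occ (u , x , v , π≡ , smaller-before , Equivalence.from (hat-excedance⇔ n π∈S π≡) (¬lrmax , ¬below)))
    where
    ¬lrmax = λ u<x → ¬ok (inj₁ (inj₂ u<x))
    ¬below = λ below → ¬ok (inj₂ below)
    smaller-before : ∃ λ y → y ∈ u × y < x
    smaller-before with find (¬All⇒Any¬ (x <?_) u (λ x<u → ¬ok (inj₁ (inj₁ x<u))))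
    ... | y , y∈u , x≮y = y , y∈u , ≤∧≢⇒< (≮⇒≥ x≮y) (λ y≡x → x∉u (subst (_∈ u) y≡x y∈u))
      where
      x∉u : x ∉ u
      x∉u = unique-∉-prefix u (subst Unique π≡ (IsPermutation.unique (∈-S⇒IsPermutation n π∈S)))
  from : EntrywiseGood π → ¬ Occurrence π
  from good (u , x , v , π≡ , (y , y∈u , y<x) , x<σx) with Equivalence.to (hat-excedance⇔ n π∈S π≡) x<σx | good u x v π≡
  ... | _      , _      | inj₁ (inj₁ x<u) = <-asym y<x (All.lookup x<u y∈u)
  ... | ¬lrmax , _      | inj₁ (inj₂ u<x) = ¬lrmax u<x
  ... | _      , ¬below | inj₂ below      = ¬below below

T-not : ∀ b → T (not b) ⇔ (¬ T b)
T-not true  = mk⇔ (λ ()) (λ ¬t → ¬t _)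
T-not false = mk⇔ (λ _ ()) (λ _ → _)

avoids⇔Good : ∀ n {π} → π ∈ S n → T (avoids 3 (1 ∷ 2 ∷ []) ((2 , 3) ∷ []) π) ⇔ Good (reverse π)
avoids⇔Good n {π} π∈S = mk⇔
  (Equivalence.from (Good-reverse⇔EntrywiseGood π) ∘ Equivalence.to (¬occurrence⇔EntrywiseGood n π∈S) ∘ (λ ¬c occ → ¬c (occurrence⇒contains n π∈S occ)) ∘ Equivalence.to (T-not (pattern₃ π)))
  (Equivalence.from (T-not (pattern₃ π)) ∘ (λ ¬occ c → ¬occ (contains⇒occurrence π c)) ∘ Equivalence.from (¬occurrence⇔EntrywiseGood n π∈S) ∘ Equivalence.to (Good-reverse⇔EntrywiseGood π))

theorem3p8 : ((n : ℕ) → 2 ≤ n → a n 3 (1 ∷ 2 ∷ []) ((2 , 3) ∷ []) ≡ 2 * Bell (n ∸ 1))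
    × (a 1 3 (1 ∷ 2 ∷ []) ((2 , 3) ∷ []) ≡ 1)
theorem3p8 = (λ { n@(suc (suc _)) _ → count n ; (suc zero) (s≤s ()) }) , count 1
  where
  count : ∀ n → a n 3 (1 ∷ 2 ∷ []) ((2 , 3) ∷ []) ≡ goodCount n
  count n = count-good (avoids 3 (1 ∷ 2 ∷ []) ((2 , 3) ∷ [])) n (avoids⇔Good n)
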